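{- Let $p>3$ be a prime and $G=D_{2p}$ the dihedral group of order $2p$. Let $k\ge3$ be an integer and $f:G\to G$ any function. If $f$ passes $\mathsf{Test\_Dihedral}_k(f)$ with probability $\delta_k(f)$, then there exists an automorphism $\varphi\in\mathrm{Aut}(G)$ with $\mathrm{agr}(f,\varphi)\ge\frac12\,\delta_k(f)^{\frac{1}{k-2}}$.
   Context: $\mathrm{agr}(f,\varphi)=\Pr_{x\sim G}[f(x)=\varphi(x)]$, $x$ uniform. For $\vec x=(x_1,\dots,x_k)\in G^k$, let $\Gamma_{\vec x}:\mathrm{Aut}(G)\to G^k$, $\varphi\mapsto(\varphi(x_1),\dots,\varphi(x_k))$, and $\mathsf{G}_{\vec x}$ its image; let $\mathrm{Stab}(\vec x)=\{\varphi\in\mathrm{Aut}(G):\varphi(x_i)=x_i\ \forall i\}$. $\mathsf{Test\_Dihedral}_k(f)$: sample $\vec x\in G^k$ with probability proportional to $|\mathrm{Stab}(\vec x)|$; accept iff $(f(x_1),\dots,f(x_k))\in\mathsf{G}_{\vec x}$, i.e. iff some automorphism $\varphi$ satisfies $\varphi(x_i)=f(x_i)$ for all $i$. -}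

module Defs where

open import Data.Bool using (Bool; true; false; if_then_else_; _∧_; _∨_; not; _xor_)
open import Data.Nat using (ℕ; zero; suc; _+_; _*_; _∸_; NonZero)
open import Data.Nat.DivMod using (_mod_)
open import Data.Fin using (Fin; toℕ)
open import Data.Fin.Properties using () renaming (_≟_ to _≟Fin_)
open import Data.Bool.Properties using () renaming (_≟_ to _≟Bool_)
open import Data.Product using (_×_; _,_; proj₁; proj₂)
open import Data.List using (List; []; _∷_; map; concatMap; length; filter)
open import Data.Bool.ListAction using (all; any)
open import Data.Nat.ListAction using (sum)
open import Data.List.Base using (allFin)
open import Data.Vec.Functional using () renaming (_∷_ to _∷ᶠ_)
open import Data.Integer using (+_)
open import Data.Rational using (ℚ; _/_; 0ℚ; 1ℚ) renaming (_*_ to _*ℚ_)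
open import Relation.Nullary using (does)

-- An element (false , a) stands for r^a, and (true , a) for r^a s,
-- where r is a rotation of order p and s a reflection, s r s = r⁻¹.

D : ℕ → Set
D p = Bool × Fin p

module _ {p : ℕ} .{{_ : NonZero p}} where

  addₚ : Fin p → Fin p → Fin p
  addₚ a c = (toℕ a + toℕ c) mod p

  negₚ : Fin p → Fin p
  negₚ c = (p ∸ toℕ c) mod p

  -- (r^a s^e)(r^c s^f) = r^(a + (-1)^e c) s^(e+f)
  _·_ : D p → D p → D p
  (e , a) · (f , c) = (e xor f , addₚ a (if e then negₚ c else c))

_==_ : {p : ℕ} → D p → D p → Bool
(e , a) == (f , c) = does (e ≟Bool f) ∧ does (a ≟Fin c)

allD : (p : ℕ) → List (D p)
allD p = map (false ,_) (allFin p) Data.List.++ map (true ,_) (allFin p)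

allFuns : {A : Set} (n : ℕ) → List A → List (Fin n → A)
allFuns zero    xs = (λ ()) ∷ []
allFuns (suc n) xs = concatMap (λ a → map (λ g → a ∷ᶠ g) (allFuns n xs)) xs

-- Self-maps of D p, represented by their restrictions to rotations and
-- to reflections; `allEndo p` lists every map D p → D p exactly once
-- (up to pointwise equality).

Endo : ℕ → Set
Endo p = (Fin p → D p) × (Fin p → D p)

app : {p : ℕ} → Endo p → D p → D p
app (φ₀ , φ₁) (false , a) = φ₀ a
app (φ₀ , φ₁) (true  , a) = φ₁ a

allEndo : (p : ℕ) → List (Endo p)
allEndo p = concatMap (λ φ₀ → map (φ₀ ,_) (allFuns p (allD p))) (allFuns p (allD p))

isAut : {p : ℕ} .{{_ : NonZero p}} → Endo p → Bool
isAut {p} φ =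
  all (λ x → all (λ y → app φ (x · y) == (app φ x · app φ y)) (allD p)) (allD p)
  ∧ all (λ x → all (λ y → not (app φ x == app φ y) ∨ (x == y)) (allD p)) (allD p)
  ∧ all (λ y → any (λ x → app φ x == y) (allD p)) (allD p)

Aut : (p : ℕ) .{{_ : NonZero p}} → List (Endo p)
Aut p = filter (λ φ → isAut φ ≟Bool true) (allEndo p)

countTrue : {A : Set} → (A → Bool) → List A → ℕ
countTrue P xs = length (filter (λ x → P x ≟Bool true) xs)

allFin' : (k : ℕ) → List (Fin k)
allFin' = allFin

-- n ÷ d as a rational (with the harmless convention n ÷ 0 = 0;
-- it is only used with d ≠ 0).
_÷ℕ_ : ℕ → ℕ → ℚ
n ÷ℕ zero  = 0ℚ
n ÷ℕ suc d = (+ n) / suc d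

_^ℚ_ : ℚ → ℕ → ℚ
q ^ℚ zero  = 1ℚ
q ^ℚ suc n = q *ℚ (q ^ℚ n)

agr : {p : ℕ} → (D p → D p) → Endo p → ℚ
agr {p} f φ = countTrue (λ x → f x == app φ x) (allD p) ÷ℕ length (allD p)

module _ {p : ℕ} .{{_ : NonZero p}} where

  stabSize : {k : ℕ} → (Fin k → D p) → ℕ
  stabSize {k} xs = countTrue (λ φ → all (λ i → app φ (xs i) == xs i) (allFin k)) (Aut p)

  -- Test accepts x⃗ iff (f(x₁),…,f(x_k)) ∈ G_x⃗, i.e. some automorphism φ
  -- has φ(xᵢ) = f(xᵢ) for all i.
  accepts : {k : ℕ} → (D p → D p) → (Fin k → D p) → Bool
  accepts {k} f xs = any (λ φ → all (λ i → app φ (xs i) == f (xs i)) (allFin k)) (Aut p)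

  -- δ_k(f): acceptance probability of Test_Dihedral_k(f), where x⃗ ∈ (D p)^k
  -- is sampled with probability proportional to |Stab(x⃗)|.
  δ : (k : ℕ) → (D p → D p) → ℚ
  δ k f = sum (map (λ xs → if accepts f xs then stabSize xs else 0) (allFuns k (allD p)))
          ÷ℕ sum (map stabSize (allFuns k (allD p)))

module Submission where

-- Write A(φ) for the number of points where the automorphism φ agrees with f,
-- and F(φ) for its number of fixed points. For x⃗ ∈ Gᵏ the automorphisms that
-- agree with f on x⃗ form either the empty set or a coset φ ∘ Stab(x⃗), so
-- counting pairs (x⃗, φ) both ways, the accepted weight is Σ_φ A(φ)ᵏ and the
-- total weight is Σ_φ F(φ)ᵏ. With M = max A we get Σ A(φ)ᵏ ≤ Mᵏ⁻² Σ A(φ)², and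
-- Σ A(φ)² ≤ Σ F(φ)² by the same coset argument for k = 2. An automorphism of
-- D_2p fixes either all p rotations or at most two elements, there are at most
-- p² automorphisms, and the identity fixes all 2p elements; this forces
-- pᵏ⁻² Σ F(φ)² ≤ Σ F(φ)ᵏ. Hence δ_k(f) ≤ (M/p)ᵏ⁻² = (2 agr(f, φ))ᵏ⁻² for a
-- maximiser φ of A.

module TestDihedral where

  open import Data.Bool using (Bool; true; false; if_then_else_; _∧_; _∨_; not)
  open import Data.Bool.Properties using () renaming (_≟_ to _≟Bool_)
  open import Data.Bool.ListAction using (and; or; all; any)
  open import Data.Empty using (⊥; ⊥-elim)
  open import Data.Fin using (Fin; toℕ)
  open import Data.Fin.Properties using (toℕ-fromℕ<; toℕ<n; toℕ-injective) renaming (_≟_ to _≟Fin_)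
  open import Data.List
    using (List; []; _∷_; map; concatMap; length; filter; _++_; tabulate; cartesianProductWith; cartesianProduct)
  open import Data.List.Base using (allFin)
  open import Data.List.Membership.Propositional using (_∈_; lose)
  open import Data.List.Relation.Binary.Subset.Propositional using (_⊆_)
  open import Data.List.Membership.Propositional.Properties
    using (∈-allFin; ∈-cartesianProduct⁺; ∈-++⁺ˡ; ∈-++⁺ʳ; ∈-++⁻; ∈-∃++; ∈-map⁺; ∈-map⁻;
           ∈-filter⁺; ∈-filter⁻)
  open import Data.List.Properties
    using (length-map; length-tabulate; tabulate-cong; length-++; map-++; map-∘; map-id; map-cong; map-tabulate;
           ∷-injective)
  open import Data.List.Relation.Unary.All as All using ([]; _∷_)
  open import Data.List.Relation.Unary.AllPairs using ([]; _∷_)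
  open import Data.List.Relation.Unary.Any using (here; there; any?; satisfied)
  open import Data.List.Relation.Unary.Unique.Propositional using (Unique)
  import Data.List.Relation.Unary.Unique.Propositional.Properties as Unique
  open import Data.Nat
    using (ℕ; zero; suc; _+_; _*_; _∸_; _^_; _%_; _≤_; _<_; z≤n; s≤s; NonZero; pred; >-nonZero; >-nonZero⁻¹)
  open import Data.Nat.DivMod
    using (_mod_; m%n<n; m<n⇒m%n≡m; %-distribˡ-+; %-distribˡ-*; m%n%n≡m%n; n%n≡0; [m+n]%n≡m%n; [m+kn]%n≡m%n)
  open import Data.Nat.ListAction using (sum)
  open import Data.Nat.Properties
  open import Data.Nat.Tactic.RingSolver using (solve-∀)
  open import Data.Nat.Primality using (Prime)
  open import Data.Nat.Coprimality using (prime⇒coprime; coprime-Bézout)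
  open import Data.Nat.GCD using (module Bézout)
  import Algebra.Properties.CommutativeSemigroup +-commutativeSemigroup as +-Semigroup
  import Algebra.Properties.CommutativeSemigroup *-commutativeSemigroup as *-Semigroup
  open import Data.Product using (∃; _×_; _,_; proj₁; proj₂)
  open import Data.Product.Properties using (,-injective; ≡-dec)
  open import Data.Sum using (_⊎_; inj₁; inj₂)
  open import Data.Vec.Functional using () renaming (_∷_ to _∷ᶠ_)
  open import Function using (_∘_; case_of_)
  open import Relation.Binary.PropositionalEquality
  open import Data.Integer using (+_)
  import Data.Integer as ℤ
  import Data.Integer.Properties as ℤ
  open import Data.Rational using (ℚ; _/_; toℚᵘ) renaming (_*_ to _*ℚ_; _≤_ to _≤ℚ_)
  open import Data.Rational.Properties using (toℚᵘ-fromℚᵘ; toℚᵘ-homo-*; toℚᵘ-cancel-≤)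
  open import Data.Rational.Unnormalised using (mkℚᵘ; *≡*; *≤*) renaming (_≃_ to _≃ᵘ_)
  open import Data.Rational.Unnormalised.Properties
    using () renaming (≃-refl to ≃ᵘ-refl; ≃-sym to ≃ᵘ-sym; ≃-trans to ≃ᵘ-trans; *-cong to *ᵘ-cong;
                       ≤-respˡ-≃ to ≤ᵘ-respˡ-≃ᵘ; ≤-respʳ-≃ to ≤ᵘ-respʳ-≃ᵘ)
  open import Relation.Nullary using (Dec; yes; no; ¬?; _×-dec_)

  open import Defs

  private variable
    A B C : Set

  -- Sums and counts over lists

  indicator : Bool → ℕ
  indicator true  = 1
  indicator false = 0

  indicator-∧ : ∀ a b → indicator (a ∧ b) ≡ indicator a * indicator b
  indicator-∧ true  b = sym (+-identityʳ (indicator b))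
  indicator-∧ false b = refl

  ∑ : (A → ℕ) → List A → ℕ
  ∑ g xs = sum (map g xs)

  ∑-cong : {g h : A → ℕ} → (∀ x → g x ≡ h x) → (xs : List A) → ∑ g xs ≡ ∑ h xs
  ∑-cong g≗h []       = refl
  ∑-cong g≗h (x ∷ xs) = cong₂ _+_ (g≗h x) (∑-cong g≗h xs)

  ∑-mono : {g h : A → ℕ} (xs : List A) → (∀ {x} → x ∈ xs → g x ≤ h x) → ∑ g xs ≤ ∑ h xs
  ∑-mono []       g≤h = z≤n
  ∑-mono (x ∷ xs) g≤h = +-mono-≤ (g≤h (here refl)) (∑-mono xs (g≤h ∘ there))

  ∑-++ : (g : A → ℕ) (xs ys : List A) → ∑ g (xs ++ ys) ≡ ∑ g xs + ∑ g ys
  ∑-++ g []       ys = refl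
  ∑-++ g (x ∷ xs) ys = trans (cong (_+_ (g x)) (∑-++ g xs ys)) (sym (+-assoc (g x) _ _))

  ∑-map : (g : B → ℕ) (h : A → B) (xs : List A) → ∑ g (map h xs) ≡ ∑ (g ∘ h) xs
  ∑-map g h []       = refl
  ∑-map g h (x ∷ xs) = cong (_+_ (g (h x))) (∑-map g h xs)

  ∑-concatMap : (g : B → ℕ) (h : A → List B) (xs : List A) →
    ∑ g (concatMap h xs) ≡ ∑ (λ x → ∑ g (h x)) xs
  ∑-concatMap g h []       = refl
  ∑-concatMap g h (x ∷ xs) =
    trans (∑-++ g (h x) (concatMap h xs)) (cong (_+_ (∑ g (h x))) (∑-concatMap g h xs))

  ∑-+ : (g h : A → ℕ) (xs : List A) → ∑ (λ x → g x + h x) xs ≡ ∑ g xs + ∑ h xs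
  ∑-+ g h []       = refl
  ∑-+ g h (x ∷ xs) =
    trans (cong (_+_ (g x + h x)) (∑-+ g h xs)) (+-Semigroup.interchange (g x) (h x) (∑ g xs) (∑ h xs))

  ∑-*ˡ : (c : ℕ) (g : A → ℕ) (xs : List A) → ∑ (λ x → c * g x) xs ≡ c * ∑ g xs
  ∑-*ˡ c g []       = sym (*-zeroʳ c)
  ∑-*ˡ c g (x ∷ xs) = trans (cong (_+_ (c * g x)) (∑-*ˡ c g xs)) (sym (*-distribˡ-+ c (g x) _))

  ∑-const : (c : ℕ) (xs : List A) → ∑ (λ _ → c) xs ≡ c * length xs
  ∑-const c []       = sym (*-zeroʳ c)
  ∑-const c (x ∷ xs) = trans (cong (_+_ c) (∑-const c xs)) (sym (*-suc c (length xs)))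

  ∑-swap : (g : A → B → ℕ) (xs : List A) (ys : List B) →
    ∑ (λ x → ∑ (g x) ys) xs ≡ ∑ (λ y → ∑ (λ x → g x y) xs) ys
  ∑-swap g []       ys = sym (∑-const 0 ys)
  ∑-swap g (x ∷ xs) ys =
    trans (cong (_+_ (∑ (g x) ys)) (∑-swap g xs ys)) (sym (∑-+ (g x) (λ y → ∑ (λ x → g x y) xs) ys))

  ∑-∈-≤ : (g : A → ℕ) {x : A} {xs : List A} → x ∈ xs → g x ≤ ∑ g xs
  ∑-∈-≤ g {xs = y ∷ ys} (here refl) = m≤m+n (g y) (∑ g ys)
  ∑-∈-≤ g {xs = y ∷ ys} (there x∈)  = ≤-trans (∑-∈-≤ g x∈) (m≤n+m (∑ g ys) (g y))

  ∑-pick : {x : A} {xs : List A} → x ∈ xs →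
    ∃ λ ys → length xs ≡ suc (length ys) × (∀ {y} → y ∈ ys → y ∈ xs) ×
             (∀ (g : A → ℕ) → ∑ g xs ≡ g x + ∑ g ys)
  ∑-pick {x = x} x∈xs with ∈-∃++ x∈xs
  ... | us , vs , refl = us ++ vs , length-split , ∈-split , ∑-split
    where
    length-split : length (us ++ x ∷ vs) ≡ suc (length (us ++ vs))
    length-split = begin
      length (us ++ x ∷ vs)        ≡⟨ length-++ us ⟩
      length us + suc (length vs)  ≡⟨ +-suc (length us) (length vs) ⟩
      suc (length us + length vs)  ≡⟨ cong suc (length-++ us) ⟨
      suc (length (us ++ vs))      ∎
      where open ≡-Reasoning
    ∈-split : ∀ {y} → y ∈ us ++ vs → y ∈ us ++ x ∷ vs
    ∈-split y∈ with ∈-++⁻ us y∈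
    ... | inj₁ y∈us = ∈-++⁺ˡ y∈us
    ... | inj₂ y∈vs = ∈-++⁺ʳ us (there y∈vs)
    ∑-split : ∀ g → ∑ g (us ++ x ∷ vs) ≡ g x + ∑ g (us ++ vs)
    ∑-split g = begin
      ∑ g (us ++ x ∷ vs)          ≡⟨ ∑-++ g us (x ∷ vs) ⟩
      ∑ g us + (g x + ∑ g vs)     ≡⟨ +-Semigroup.x∙yz≈y∙xz (∑ g us) (g x) (∑ g vs) ⟩
      g x + (∑ g us + ∑ g vs)     ≡⟨ cong (_+_ (g x)) (∑-++ g us vs) ⟨
      g x + ∑ g (us ++ vs)        ∎
      where open ≡-Reasoning

  countTrue≡∑ : (P : A → Bool) (xs : List A) → countTrue P xs ≡ ∑ (indicator ∘ P) xs
  countTrue≡∑ P []       = refl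
  countTrue≡∑ P (x ∷ xs) with P x
  ... | true  = cong suc (countTrue≡∑ P xs)
  ... | false = countTrue≡∑ P xs

  countTrue-cong : {P Q : A → Bool} → (∀ x → P x ≡ Q x) → (xs : List A) → countTrue P xs ≡ countTrue Q xs
  countTrue-cong {P = P} {Q} P≗Q xs = begin
    countTrue P xs          ≡⟨ countTrue≡∑ P xs ⟩
    ∑ (indicator ∘ P) xs    ≡⟨ ∑-cong (cong indicator ∘ P≗Q) xs ⟩
    ∑ (indicator ∘ Q) xs    ≡⟨ countTrue≡∑ Q xs ⟨
    countTrue Q xs          ∎
    where open ≡-Reasoning

  countTrue-swap : (R : A → B → Bool) (xs : List A) (ys : List B) →
    ∑ (λ x → countTrue (R x) ys) xs ≡ ∑ (λ y → countTrue (λ x → R x y) xs) ys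
  countTrue-swap R xs ys = begin
    ∑ (λ x → countTrue (R x) ys) xs                       ≡⟨ ∑-cong (λ x → countTrue≡∑ (R x) ys) xs ⟩
    ∑ (λ x → ∑ (λ y → indicator (R x y)) ys) xs           ≡⟨ ∑-swap (λ x y → indicator (R x y)) xs ys ⟩
    ∑ (λ y → ∑ (λ x → indicator (R x y)) xs) ys           ≡⟨ ∑-cong (λ y → countTrue≡∑ (λ x → R x y) xs) ys ⟨
    ∑ (λ y → countTrue (λ x → R x y) xs) ys               ∎
    where open ≡-Reasoning

  countTrue-all : (P : A → Bool) (xs : List A) → (∀ {x} → x ∈ xs → P x ≡ true) →
    countTrue P xs ≡ length xs
  countTrue-all P []       Pxs = refl
  countTrue-all P (x ∷ xs) Pxs with P x | Pxs (here refl)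
  ... | true | refl = cong suc (countTrue-all P xs (Pxs ∘ there))

  countTrue≡0 : (P : A → Bool) (xs : List A) → (∀ {x} → x ∈ xs → P x ≢ true) → countTrue P xs ≡ 0
  countTrue≡0 P []       _    = refl
  countTrue≡0 P (x ∷ xs) ¬Pxs with P x in Px
  ... | true  = ⊥-elim (¬Pxs (here refl) Px)
  ... | false = countTrue≡0 P xs (¬Pxs ∘ there)

  countTrue≤1 : (P : A → Bool) (xs : List A) → Unique xs →
    (∀ {x y} → x ∈ xs → y ∈ xs → P x ≡ true → P y ≡ true → x ≡ y) → countTrue P xs ≤ 1
  countTrue≤1 P []       _              _ = z≤n
  countTrue≤1 P (x ∷ xs) (x∉xs ∷ uniq) P-single with P x in Px
  ... | false = countTrue≤1 P xs uniq (λ y∈ z∈ → P-single (there y∈) (there z∈))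
  ... | true  = s≤s (≤-reflexive (countTrue≡0 P xs
                  (λ y∈ Py → All.lookup x∉xs y∈ (P-single (here refl) (there y∈) Px Py))))

  ∃-maximum : (g : A → ℕ) {xs : List A} {x : A} → x ∈ xs →
    ∃ λ y → y ∈ xs × (∀ {z} → z ∈ xs → g z ≤ g y)
  ∃-maximum g {x ∷ []}      (here refl) = x , here refl , λ { (here refl) → ≤-refl }
  ∃-maximum g {x ∷ x′ ∷ xs} _ with ∃-maximum g {x′ ∷ xs} (here refl)
  ... | y , y∈ , y-max with g x ≤? g y
  ...   | yes gx≤gy = y , there y∈ , λ { (here refl) → gx≤gy ; (there z∈) → y-max z∈ }
  ...   | no  gx≰gy = x , here refl ,
    λ { (here refl) → ≤-refl ; (there z∈) → ≤-trans (y-max z∈) (<⇒≤ (≰⇒> gx≰gy)) }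

  ∑-^-≤-max : (g : A → ℕ) (M j : ℕ) (xs : List A) → (∀ {x} → x ∈ xs → g x ≤ M) →
    ∑ (λ x → g x ^ (2 + j)) xs ≤ M ^ j * ∑ (λ x → g x ^ 2) xs
  ∑-^-≤-max g M j xs g≤M = begin
    ∑ (λ x → g x ^ (2 + j)) xs        ≡⟨ ∑-cong (λ x → ^-split (g x)) xs ⟩
    ∑ (λ x → g x ^ j * g x ^ 2) xs    ≤⟨ ∑-mono xs (λ x∈ → *-monoˡ-≤ _ (^-monoˡ-≤ j (g≤M x∈))) ⟩
    ∑ (λ x → M ^ j * g x ^ 2) xs      ≡⟨ ∑-*ˡ (M ^ j) _ xs ⟩
    M ^ j * ∑ (λ x → g x ^ 2) xs      ∎
    where
    open ≤-Reasoning
    ^-split : ∀ a → a ^ (2 + j) ≡ a ^ j * a ^ 2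
    ^-split a = trans (^-distribˡ-+-* a 2 j) (*-comm (a ^ 2) (a ^ j))

  -- The single large value g ι = 2p pays for the deficit of up to p² values g x ≤ 2.
  ^-*-∑²≤∑-^ : (g : A → ℕ) (p i : ℕ) (xs : List A) {ι : A} → ι ∈ xs → g ι ≡ p + p → length xs ≤ p * p →
    (∀ {x} → x ∈ xs → p ≤ g x ⊎ g x ≤ 2) →
    p ^ suc i * ∑ (λ x → g x ^ 2) xs ≤ ∑ (λ x → g x ^ (3 + i)) xs
  ^-*-∑²≤∑-^ {A} g p i xs {ι} ι∈ gι≡2p length≤p² large⊎small
    with ys , length≡ , ys⊆xs , ∑-split ← ∑-pick ι∈ = begin
    T * ∑ (λ x → g x ^ 2) xs                          ≡⟨ ∑-*ˡ T _ xs ⟨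
    ∑ (λ x → T * g x ^ 2) xs                          ≡⟨ ∑-split _ ⟩
    T * g ι ^ 2 + ∑ (λ x → T * g x ^ 2) ys            ≤⟨ +-monoʳ-≤ (T * g ι ^ 2) rest ⟩
    T * g ι ^ 2 + (∑ gᵏ ys + 4 * T * length ys)       ≤⟨ +-monoʳ-≤ (T * g ι ^ 2)
                                                           (+-monoʳ-≤ (∑ gᵏ ys) (*-monoʳ-≤ (4 * T) length-ys≤p²)) ⟩
    T * g ι ^ 2 + (∑ gᵏ ys + 4 * T * (p * p))         ≡⟨ +-Semigroup.x∙yz≈y∙xz (T * g ι ^ 2) (∑ gᵏ ys) _ ⟩
    ∑ gᵏ ys + (T * g ι ^ 2 + 4 * T * (p * p))         ≤⟨ +-monoʳ-≤ (∑ gᵏ ys) ι-surplus ⟩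
    ∑ gᵏ ys + gᵏ ι                                    ≡⟨ +-comm (∑ gᵏ ys) (gᵏ ι) ⟩
    gᵏ ι + ∑ gᵏ ys                                    ≡⟨ ∑-split gᵏ ⟨
    ∑ gᵏ xs                                           ∎
    where
    open ≤-Reasoning
    T = p ^ suc i
    gᵏ : A → ℕ
    gᵏ x = g x ^ (3 + i)
    length-ys≤p² : length ys ≤ p * p
    length-ys≤p² = ≤-trans (n≤1+n (length ys)) (subst (_≤ p * p) length≡ length≤p²)
    per-element : ∀ {x} → x ∈ xs → T * g x ^ 2 ≤ gᵏ x + 4 * T
    per-element {x} x∈ with large⊎small x∈
    ... | inj₁ p≤gx = ≤-trans (begin
      T * g x ^ 2          ≤⟨ *-monoˡ-≤ (g x ^ 2) (^-monoˡ-≤ (suc i) p≤gx) ⟩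
      g x ^ suc i * g x ^ 2 ≡⟨ ^-distribˡ-+-* (g x) (suc i) 2 ⟨
      g x ^ (suc i + 2)    ≡⟨ cong (g x ^_) (+-comm (suc i) 2) ⟩
      gᵏ x                 ∎) (m≤m+n (gᵏ x) (4 * T))
    ... | inj₂ gx≤2 = ≤-trans (begin
      T * g x ^ 2          ≤⟨ *-monoʳ-≤ T (^-monoˡ-≤ 2 gx≤2) ⟩
      T * 4                ≡⟨ *-comm T 4 ⟩
      4 * T                ∎) (m≤n+m (4 * T) (gᵏ x))
    rest : ∑ (λ x → T * g x ^ 2) ys ≤ ∑ gᵏ ys + 4 * T * length ys
    rest = begin
      ∑ (λ x → T * g x ^ 2) ys          ≤⟨ ∑-mono ys (per-element ∘ ys⊆xs) ⟩
      ∑ (λ x → gᵏ x + 4 * T) ys         ≡⟨ ∑-+ gᵏ (λ _ → 4 * T) ys ⟩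
      ∑ gᵏ ys + ∑ (λ _ → 4 * T) ys      ≡⟨ cong (_+_ (∑ gᵏ ys)) (∑-const (4 * T) ys) ⟩
      ∑ gᵏ ys + 4 * T * length ys       ∎
    ι-surplus : T * g ι ^ 2 + 4 * T * (p * p) ≤ gᵏ ι
    ι-surplus rewrite gι≡2p = begin
      T * (p + p) ^ 2 + 4 * T * (p * p)                  ≡⟨ expand p (p ^ i) ⟩
      (p + p) * ((p + p) * ((p + p) * p ^ i))
        ≤⟨ *-monoʳ-≤ (p + p) (*-monoʳ-≤ (p + p) (*-monoʳ-≤ (p + p) (^-monoˡ-≤ i (m≤m+n p p)))) ⟩
      (p + p) ^ (3 + i)                                  ∎
      where
      expand : ∀ p t → p * t * ((p + p) * ((p + p) * 1)) + 4 * (p * t) * (p * p) ≡ (p + p) * ((p + p) * ((p + p) * t))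
      expand = solve-∀

  ∧≡true⇒ : ∀ a b → a ∧ b ≡ true → a ≡ true × b ≡ true
  ∧≡true⇒ true true _ = refl , refl

  all-elim : (P : A → Bool) {xs : List A} → all P xs ≡ true → ∀ {x} → x ∈ xs → P x ≡ true
  all-elim P {y ∷ _} h (here refl) with P y | h
  ... | true | _ = refl
  all-elim P {y ∷ _} h (there x∈) with P y | h
  ... | true | h′ = all-elim P h′ x∈

  all-intro : (P : A → Bool) (xs : List A) → (∀ {x} → x ∈ xs → P x ≡ true) → all P xs ≡ true
  all-intro P []       _   = refl
  all-intro P (x ∷ xs) Pxs rewrite Pxs (here refl) = all-intro P xs (Pxs ∘ there)

  any-elim : (P : A → Bool) (xs : List A) → any P xs ≡ true → ∃ λ x → x ∈ xs × P x ≡ true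
  any-elim P (x ∷ xs) h with P x in Px
  ... | true  = x , here refl , Px
  ... | false = let y , y∈ , Py = any-elim P xs h in y , there y∈ , Py

  any-intro : (P : A → Bool) {xs : List A} {x : A} → x ∈ xs → P x ≡ true → any P xs ≡ true
  any-intro P (here refl) Px rewrite Px = refl
  any-intro P {y ∷ _} (there x∈) Px with P y
  ... | true  = refl
  ... | false = any-intro P x∈ Px

  all-cong : {P Q : A → Bool} → (∀ x → P x ≡ Q x) → (xs : List A) → all P xs ≡ all Q xs
  all-cong P≗Q xs = cong and (map-cong P≗Q xs)

  any-cong : {P Q : A → Bool} → (∀ x → P x ≡ Q x) → (xs : List A) → any P xs ≡ any Q xs
  any-cong P≗Q xs = cong or (map-cong P≗Q xs)

  all-allFin-suc : {k : ℕ} (h : Fin (suc k) → Bool) →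
    all h (allFin (suc k)) ≡ h Fin.zero ∧ all (h ∘ Fin.suc) (allFin k)
  all-allFin-suc h = cong (h Fin.zero ∧_) (cong and
    (trans (map-tabulate Fin.suc h) (sym (map-tabulate (λ i → i) (h ∘ Fin.suc)))))

  firstOr : (A → Bool) → A → List A → A
  firstOr P d []       = d
  firstOr P d (x ∷ xs) = if P x then x else firstOr P d xs

  firstOr-satisfies : (P : A → Bool) (d : A) (xs : List A) → any P xs ≡ true → P (firstOr P d xs) ≡ true
  firstOr-satisfies P d (x ∷ xs) h with P x in Px
  ... | true  = Px
  ... | false = firstOr-satisfies P d xs h

  Unique⇒length≤ : {xs ys : List A} → Unique xs → xs ⊆ ys → length xs ≤ length ys
  Unique⇒length≤ {xs = []}              _              _     = z≤n
  Unique⇒length≤ {xs = x ∷ xs} {ys} (x∉xs ∷ uniq) xs⊆ys with ∈-∃++ (xs⊆ys (here refl))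
  ... | us , vs , refl = begin
    suc (length xs)              ≤⟨ s≤s (Unique⇒length≤ uniq xs⊆us++vs) ⟩
    suc (length (us ++ vs))      ≡⟨ cong suc (length-++ us) ⟩
    suc (length us + length vs)  ≡⟨ +-suc (length us) (length vs) ⟨
    length us + length (x ∷ vs)  ≡⟨ length-++ us ⟨
    length (us ++ x ∷ vs)        ∎
    where
    open ≤-Reasoning
    xs⊆us++vs : xs ⊆ us ++ vs
    xs⊆us++vs {y} y∈xs with ∈-++⁻ us (xs⊆ys (there y∈xs))
    ... | inj₁ y∈us         = ∈-++⁺ˡ y∈us
    ... | inj₂ (here refl)  = ⊥-elim (All.lookup x∉xs y∈xs refl)
    ... | inj₂ (there y∈vs) = ∈-++⁺ʳ us y∈vs

  Unique-map-via : (t : A → B) (t′ : A → C) (xs : List A) →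
    (∀ {x y} → x ∈ xs → y ∈ xs → t′ x ≡ t′ y → t x ≡ t y) →
    Unique (map t xs) → Unique (map t′ xs)
  Unique-map-via t t′ []       _     _              = []
  Unique-map-via t t′ (x ∷ xs) t-det (tx∉ ∷ uniq) =
    All.tabulate (λ t′y∈ t′x≡ → let y , y∈ , z≡ = ∈-map⁻ t′ t′y∈ in
                   All.lookup tx∉ (∈-map⁺ t y∈) (t-det (here refl) (there y∈) (trans t′x≡ z≡)))
    ∷ Unique-map-via t t′ xs (λ x∈ y∈ → t-det (there x∈) (there y∈)) uniq

  Unique-map-filter : (t : A → B) (P : A → Bool) (xs : List A) →
    Unique (map t xs) → Unique (map t (filter (λ x → P x ≟Bool true) xs))
  Unique-map-filter t P []       _              = []
  Unique-map-filter t P (x ∷ xs) (tx∉ ∷ uniq) with P x ≟Bool true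
  ... | yes _ = All.tabulate (λ ty∈ tx≡ → let y , y∈ , z≡ = ∈-map⁻ t ty∈ in
                  All.lookup tx∉ (∈-map⁺ t (proj₁ (∈-filter⁻ (λ x → P x ≟Bool true) y∈))) (trans tx≡ z≡))
                ∷ Unique-map-filter t P xs uniq
  ... | no  _ = Unique-map-filter t P xs uniq

  ∈-concatMap⁺ : (h : A → List B) {xs : List A} {x : A} {y : B} → x ∈ xs → y ∈ h x → y ∈ concatMap h xs
  ∈-concatMap⁺ h (here refl) y∈ = ∈-++⁺ˡ y∈
  ∈-concatMap⁺ h {x ∷ _} (there x∈) y∈ = ∈-++⁺ʳ (h x) (∈-concatMap⁺ h x∈ y∈)

  concatMap-map≡cartesianProductWith : (c : A → B → C) (xs : List A) (ys : List B) →
    concatMap (λ x → map (c x) ys) xs ≡ cartesianProductWith c xs ys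
  concatMap-map≡cartesianProductWith c []       ys = refl
  concatMap-map≡cartesianProductWith c (x ∷ xs) ys =
    cong (map (c x) ys ++_) (concatMap-map≡cartesianProductWith c xs ys)

  map-cartesianProductWith : {A′ B′ C′ : Set} (t : C → C′) (c : A → B → C) (c′ : A′ → B′ → C′)
    (tˡ : A → A′) (tʳ : B → B′) → (∀ x y → t (c x y) ≡ c′ (tˡ x) (tʳ y)) → (xs : List A) (ys : List B) →
    map t (cartesianProductWith c xs ys) ≡ cartesianProductWith c′ (map tˡ xs) (map tʳ ys)
  map-cartesianProductWith t c c′ tˡ tʳ t-hom []       ys = refl
  map-cartesianProductWith t c c′ tˡ tʳ t-hom (x ∷ xs) ys = begin
    map t (map (c x) ys ++ cartesianProductWith c xs ys)
      ≡⟨ map-++ t (map (c x) ys) _ ⟩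
    map t (map (c x) ys) ++ map t (cartesianProductWith c xs ys)
      ≡⟨ cong₂ _++_ (trans (sym (map-∘ ys)) (trans (map-cong (t-hom x) ys) (map-∘ ys)))
                    (map-cartesianProductWith t c c′ tˡ tʳ t-hom xs ys) ⟩
    map (c′ (tˡ x)) (map tʳ ys) ++ cartesianProductWith c′ (map tˡ xs) (map tʳ ys) ∎
    where open ≡-Reasoning

  length-cartesianProduct : (xs : List A) (ys : List B) →
    length (cartesianProduct xs ys) ≡ length xs * length ys
  length-cartesianProduct []       ys = refl
  length-cartesianProduct (x ∷ xs) ys = begin
    length (map (x ,_) ys ++ cartesianProduct xs ys)        ≡⟨ length-++ (map (x ,_) ys) ⟩
    length (map (x ,_) ys) + length (cartesianProduct xs ys)
      ≡⟨ cong₂ _+_ (length-map (x ,_) ys) (length-cartesianProduct xs ys) ⟩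
    length ys + length xs * length ys                       ∎
    where open ≡-Reasoning

  length-allFin : ∀ n → length (allFin n) ≡ n
  length-allFin n = length-tabulate {n = n} (λ i → i)

  tabulate-injective : {n : ℕ} {f g : Fin n → A} → tabulate f ≡ tabulate g → ∀ i → f i ≡ g i
  tabulate-injective {n = suc n} eq Fin.zero    = proj₁ (∷-injective eq)
  tabulate-injective {n = suc n} eq (Fin.suc i) = tabulate-injective (proj₂ (∷-injective eq)) i

  allFuns-complete : (n : ℕ) (xs : List A) (g : Fin n → A) → (∀ i → g i ∈ xs) →
    ∃ λ h → h ∈ allFuns n xs × (∀ i → h i ≡ g i)
  allFuns-complete zero    xs g _     = (λ ()) , here refl , (λ ())
  allFuns-complete (suc n) xs g g∈xs =
    let h , h∈ , h≗ = allFuns-complete n xs (g ∘ Fin.suc) (g∈xs ∘ Fin.suc) in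
    g Fin.zero ∷ᶠ h ,
    ∈-concatMap⁺ (λ a → map (a ∷ᶠ_) (allFuns n xs)) (g∈xs Fin.zero) (∈-map⁺ _ h∈) ,
    λ { Fin.zero → refl ; (Fin.suc i) → h≗ i }

  allFuns-unique : (n : ℕ) (xs : List A) → Unique xs → Unique (map tabulate (allFuns n xs))
  allFuns-unique zero    xs _    = [] ∷ []
  allFuns-unique (suc n) xs uniq
    rewrite concatMap-map≡cartesianProductWith _∷ᶠ_ xs (allFuns n xs)
          | map-cartesianProductWith tabulate _∷ᶠ_ _∷_ (λ x → x) tabulate (λ _ _ → refl) xs (allFuns n xs)
          | map-id xs
    = Unique.cartesianProductWith⁺ _∷_ ∷-injective uniq (allFuns-unique n xs uniq)

  countTrue-allFuns : (P : A → Bool) (k : ℕ) (xs : List A) →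
    countTrue (λ g → all (P ∘ g) (allFin k)) (allFuns k xs) ≡ countTrue P xs ^ k
  countTrue-allFuns P zero    xs = refl
  countTrue-allFuns P (suc k) xs = begin
    countTrue (λ g → all (P ∘ g) (allFin (suc k))) (allFuns (suc k) xs)
      ≡⟨ countTrue≡∑ _ (allFuns (suc k) xs) ⟩
    ∑ (λ g → indicator (all (P ∘ g) (allFin (suc k)))) (concatMap (λ a → map (a ∷ᶠ_) (allFuns k xs)) xs)
      ≡⟨ ∑-concatMap _ _ xs ⟩
    ∑ (λ a → ∑ (λ g → indicator (all (P ∘ g) (allFin (suc k)))) (map (a ∷ᶠ_) (allFuns k xs))) xs
      ≡⟨ ∑-cong (λ a → ∑-map _ (a ∷ᶠ_) (allFuns k xs)) xs ⟩
    ∑ (λ a → ∑ (λ g → indicator (all (P ∘ (a ∷ᶠ g)) (allFin (suc k)))) (allFuns k xs)) xs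
      ≡⟨ ∑-cong (λ a → ∑-cong (λ g → cong indicator (all-allFin-suc (P ∘ (a ∷ᶠ g)))) (allFuns k xs)) xs ⟩
    ∑ (λ a → ∑ (λ g → indicator (P a ∧ all (P ∘ g) (allFin k))) (allFuns k xs)) xs
      ≡⟨ ∑-cong (λ a → ∑-cong (λ g → indicator-∧ (P a) _) (allFuns k xs)) xs ⟩
    ∑ (λ a → ∑ (λ g → indicator (P a) * indicator (all (P ∘ g) (allFin k))) (allFuns k xs)) xs
      ≡⟨ ∑-cong (λ a → ∑-*ˡ (indicator (P a)) _ (allFuns k xs)) xs ⟩
    ∑ (λ a → indicator (P a) * ∑ (λ g → indicator (all (P ∘ g) (allFin k))) (allFuns k xs)) xs
      ≡⟨ ∑-cong (λ a → cong (indicator (P a) *_) (trans (sym (countTrue≡∑ _ (allFuns k xs)))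
                                                          (countTrue-allFuns P k xs))) xs ⟩
    ∑ (λ a → indicator (P a) * countTrue P xs ^ k) xs
      ≡⟨ ∑-cong (λ a → *-comm (indicator (P a)) _) xs ⟩
    ∑ (λ a → countTrue P xs ^ k * indicator (P a)) xs
      ≡⟨ ∑-*ˡ (countTrue P xs ^ k) _ xs ⟩
    countTrue P xs ^ k * ∑ (indicator ∘ P) xs
      ≡⟨ cong (countTrue P xs ^ k *_) (countTrue≡∑ P xs) ⟨
    countTrue P xs ^ k * countTrue P xs
      ≡⟨ *-comm _ (countTrue P xs) ⟩
    countTrue P xs ^ suc k ∎
    where open ≡-Reasoning

  -- Fractions

  ^-distribʳ-* : ∀ m n j → (m * n) ^ j ≡ m ^ j * n ^ j
  ^-distribʳ-* m n zero    = refl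
  ^-distribʳ-* m n (suc j) = trans (cong (m * n *_) (^-distribʳ-* m n j)) (interchange m n (m ^ j) (n ^ j))
    where
    interchange : ∀ a b c d → a * b * (c * d) ≡ a * c * (b * d)
    interchange = solve-∀

  -- IsFraction q a b says q = a / (1 + b).
  IsFraction : ℚ → ℕ → ℕ → Set
  IsFraction q a b = toℚᵘ q ≃ᵘ mkℚᵘ (+ a) b

  fraction-÷ℕ : (a b : ℕ) → IsFraction (a ÷ℕ suc b) a b
  fraction-÷ℕ a b = toℚᵘ-fromℚᵘ (mkℚᵘ (+ a) b)

  fraction-* : {x y : ℚ} {a b c d : ℕ} → IsFraction x a b → IsFraction y c d →
    IsFraction (x *ℚ y) (a * c) (d + b * suc d)
  fraction-* {x} {y} {a} {b} {c} {d} x≃a/b y≃c/d =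
    ≃ᵘ-trans (toℚᵘ-homo-* x y) (≃ᵘ-trans (*ᵘ-cong x≃a/b y≃c/d)
      (*≡* (cong (ℤ._* (+ suc (d + b * suc d))) (sym (ℤ.pos-* a c)))))

  -- predPow b j = (1 + b) ^ j - 1, in the form in which it arises as the denominator of a power.
  predPow : ℕ → ℕ → ℕ
  predPow b zero    = 0
  predPow b (suc j) = predPow b j + b * suc (predPow b j)

  suc-predPow : ∀ b j → suc (predPow b j) ≡ suc b ^ j
  suc-predPow b zero    = refl
  suc-predPow b (suc j) = cong (suc b *_) (suc-predPow b j)

  fraction-^ℚ : {x : ℚ} {a b : ℕ} → IsFraction x a b → ∀ j → IsFraction (x ^ℚ j) (a ^ j) (predPow b j)
  fraction-^ℚ x≃a/b zero    = ≃ᵘ-refl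
  fraction-^ℚ x≃a/b (suc j) = fraction-* x≃a/b (fraction-^ℚ x≃a/b j)

  fraction-≤ : {x y : ℚ} {a b c d : ℕ} → IsFraction x a b → IsFraction y c d →
    a * suc d ≤ c * suc b → x ≤ℚ y
  fraction-≤ {x} {y} {a} {b} {c} {d} x≃a/b y≃c/d ad≤cb = toℚᵘ-cancel-≤
    (≤ᵘ-respˡ-≃ᵘ (≃ᵘ-sym x≃a/b) (≤ᵘ-respʳ-≃ᵘ (≃ᵘ-sym y≃c/d)
      (*≤* (subst₂ ℤ._≤_ (ℤ.pos-* a (suc d)) (ℤ.pos-* c (suc b)) (ℤ.+≤+ ad≤cb)))))

  ÷ℕ≤[2*÷ℕ]^ : ∀ N D M P j → 0 < D → 0 < P → N * P ^ j ≤ M ^ j * D →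
    (N ÷ℕ D) ≤ℚ (((+ 2) / 1) *ℚ (M ÷ℕ (P + P))) ^ℚ j
  ÷ℕ≤[2*÷ℕ]^ N (suc d) M (suc q) j _ _ NPʲ≤MʲD =
    fraction-≤ (fraction-÷ℕ N d) (fraction-^ℚ (fraction-* (fraction-÷ℕ 2 0) (fraction-÷ℕ M (q + suc q))) j) (begin
      N * suc (predPow b j)    ≡⟨ cong (N *_) (trans (suc-predPow b j) (trans (cong (_^ j) 1+b≡2P) (^-distribʳ-* 2 P j))) ⟩
      N * (2 ^ j * P ^ j)      ≡⟨ *-Semigroup.x∙yz≈y∙xz N (2 ^ j) (P ^ j) ⟩
      2 ^ j * (N * P ^ j)      ≤⟨ *-monoʳ-≤ (2 ^ j) NPʲ≤MʲD ⟩
      2 ^ j * (M ^ j * suc d)  ≡⟨ *-assoc (2 ^ j) (M ^ j) (suc d) ⟨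
      2 ^ j * M ^ j * suc d    ≡⟨ cong (_* suc d) (^-distribʳ-* 2 M j) ⟨
      (2 * M) ^ j * suc d      ∎)
    where
    open ≤-Reasoning
    P = suc q
    b = q + suc q + 0 * suc (q + suc q)
    1+b≡2P : suc b ≡ 2 * P
    1+b≡2P = e q
      where
      e : ∀ q → suc (q + suc q + 0 * suc (q + suc q)) ≡ 2 * suc q
      e = solve-∀

  -- Automorphisms of D p

  module Automorphisms (p : ℕ) .{{_ : NonZero p}} where

    ==⇒≡ : (x y : D p) → (x == y) ≡ true → x ≡ y
    ==⇒≡ (e , a) (f , c) x==y with e ≟Bool f | a ≟Fin c | x==y
    ... | yes refl | yes refl | _ = refl

    ≡⇒== : (x y : D p) → x ≡ y → (x == y) ≡ true
    ≡⇒== (e , a) _ refl with e ≟Bool e | a ≟Fin a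
    ... | yes _ | yes _  = refl
    ... | no e≢e | _     = ⊥-elim (e≢e refl)
    ... | yes _ | no a≢a = ⊥-elim (a≢a refl)

    ==-sym : (x y : D p) → (x == y) ≡ (y == x)
    ==-sym x y with x == y in x==y | y == x in y==x
    ... | true  | true  = refl
    ... | false | false = refl
    ... | true  | false = trans (sym (≡⇒== y x (sym (==⇒≡ x y x==y)))) y==x
    ... | false | true  = trans (sym x==y) (≡⇒== x y (sym (==⇒≡ y x y==x)))

    rotation reflection : Fin p → D p
    rotation   a = false , a
    reflection a = true  , a

    _≟D_ : (x y : D p) → Dec (x ≡ y)
    _≟D_ = ≡-dec _≟Bool_ _≟Fin_

    ∈-allD : (x : D p) → x ∈ allD p
    ∈-allD (false , a) = ∈-++⁺ˡ (∈-map⁺ rotation (∈-allFin a))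
    ∈-allD (true  , a) = ∈-++⁺ʳ (map rotation (allFin p)) (∈-map⁺ reflection (∈-allFin a))

    allD-unique : Unique (allD p)
    allD-unique = Unique.++⁺ (Unique.map⁺ (proj₂ ∘ ,-injective) (Unique.allFin⁺ p))
                             (Unique.map⁺ (proj₂ ∘ ,-injective) (Unique.allFin⁺ p))
                             disjoint
      where
      disjoint : ∀ {x} → x ∈ map rotation (allFin p) × x ∈ map reflection (allFin p) → ⊥
      disjoint (x∈₁ , x∈₂) with ∈-map⁻ rotation x∈₁ | ∈-map⁻ reflection x∈₂
      ... | _ , _ , refl | _ , _ , ()

    length-allD : length (allD p) ≡ p + p
    length-allD = begin
      length (map rotation (allFin p) ++ map reflection (allFin p))
        ≡⟨ length-++ (map rotation (allFin p)) ⟩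
      length (map rotation (allFin p)) + length (map reflection (allFin p))
        ≡⟨ cong₂ _+_ (length-map rotation (allFin p)) (length-map reflection (allFin p)) ⟩
      length (allFin p) + length (allFin p)
        ≡⟨ cong₂ _+_ (length-allFin p) (length-allFin p) ⟩
      p + p ∎
      where open ≡-Reasoning

    countTrue-allD : (P : D p → Bool) →
      countTrue P (allD p) ≡ countTrue (P ∘ rotation) (allFin p) + countTrue (P ∘ reflection) (allFin p)
    countTrue-allD P = begin
      countTrue P (allD p)
        ≡⟨ countTrue≡∑ P (allD p) ⟩
      ∑ (indicator ∘ P) (map rotation (allFin p) ++ map reflection (allFin p))
        ≡⟨ ∑-++ (indicator ∘ P) (map rotation (allFin p)) _ ⟩
      ∑ (indicator ∘ P) (map rotation (allFin p)) + ∑ (indicator ∘ P) (map reflection (allFin p))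
        ≡⟨ cong₂ _+_ (∑-map _ rotation (allFin p)) (∑-map _ reflection (allFin p)) ⟩
      ∑ (indicator ∘ P ∘ rotation) (allFin p) + ∑ (indicator ∘ P ∘ reflection) (allFin p)
        ≡⟨ cong₂ _+_ (countTrue≡∑ (P ∘ rotation) (allFin p)) (countTrue≡∑ (P ∘ reflection) (allFin p)) ⟨
      countTrue (P ∘ rotation) (allFin p) + countTrue (P ∘ reflection) (allFin p) ∎
      where open ≡-Reasoning

    infix 4 _≈_
    _≈_ : Endo p → Endo p → Set
    φ ≈ ψ = ∀ x → app φ x ≡ app ψ x

    -- Endomorphisms as functions are compared extensionally; their tables are
    -- compared with propositional equality, which is what list uniqueness needs.
    table : Endo p → List (D p) × List (D p)
    table (φ₀ , φ₁) = tabulate φ₀ , tabulate φ₁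

    table-cong : (φ ψ : Endo p) → φ ≈ ψ → table φ ≡ table ψ
    table-cong _ _ φ≈ψ = cong₂ _,_ (tabulate-cong (φ≈ψ ∘ rotation)) (tabulate-cong (φ≈ψ ∘ reflection))

    table-injective : (φ ψ : Endo p) → table φ ≡ table ψ → φ ≈ ψ
    table-injective (φ₀ , φ₁) (ψ₀ , ψ₁) eq (false , a) = tabulate-injective (proj₁ (,-injective eq)) a
    table-injective (φ₀ , φ₁) (ψ₀ , ψ₁) eq (true  , a) = tabulate-injective (proj₂ (,-injective eq)) a

    allEndo-unique : Unique (map table (allEndo p))
    allEndo-unique = subst Unique (sym allEndo-tables)
      (Unique.cartesianProductWith⁺ _,_ ,-injective funs-unique funs-unique)
      where
      funs = allFuns p (allD p)
      funs-unique = allFuns-unique p (allD p) allD-unique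
      allEndo-tables : map table (allEndo p) ≡ cartesianProductWith _,_ (map tabulate funs) (map tabulate funs)
      allEndo-tables = trans (cong (map table) (concatMap-map≡cartesianProductWith _,_ funs funs))
        (map-cartesianProductWith table _,_ _,_ tabulate tabulate (λ _ _ → refl) funs funs)

    allEndo-complete : (φ : Endo p) → ∃ λ ψ → ψ ∈ allEndo p × ψ ≈ φ
    allEndo-complete (φ₀ , φ₁) =
      let h₀ , h₀∈ , h₀≗ = allFuns-complete p (allD p) φ₀ (∈-allD ∘ φ₀)
          h₁ , h₁∈ , h₁≗ = allFuns-complete p (allD p) φ₁ (∈-allD ∘ φ₁)
      in (h₀ , h₁) ,
         ∈-concatMap⁺ (λ φ₀ → map (φ₀ ,_) (allFuns p (allD p))) h₀∈ (∈-map⁺ _ h₁∈) ,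
         λ { (false , a) → h₀≗ a ; (true , a) → h₁≗ a }

    isAut-cong : (φ ψ : Endo p) → φ ≈ ψ → isAut φ ≡ isAut ψ
    isAut-cong φ ψ φ≈ψ =
      cong₂ _∧_ (all-cong (λ x → all-cong (λ y → hom-cong x y) (allD p)) (allD p))
      (cong₂ _∧_ (all-cong (λ x → all-cong (λ y → inj-cong x y) (allD p)) (allD p))
                 (all-cong (λ y → any-cong (λ x → cong (_== y) (φ≈ψ x)) (allD p)) (allD p)))
      where
      hom-cong : ∀ x y → (app φ (x · y) == (app φ x · app φ y)) ≡ (app ψ (x · y) == (app ψ x · app ψ y))
      hom-cong x y = cong₂ _==_ (φ≈ψ (x · y)) (cong₂ _·_ (φ≈ψ x) (φ≈ψ y))
      inj-cong : ∀ x y → (not (app φ x == app φ y) ∨ (x == y)) ≡ (not (app ψ x == app ψ y) ∨ (x == y))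
      inj-cong x y = cong (λ b → not b ∨ (x == y)) (cong₂ _==_ (φ≈ψ x) (φ≈ψ y))

    Aut-unique : Unique (map table (Aut p))
    Aut-unique = Unique-map-filter table isAut (allEndo p) allEndo-unique

    Aut-sound : {φ : Endo p} → φ ∈ Aut p → isAut φ ≡ true
    Aut-sound φ∈ = proj₂ (∈-filter⁻ (λ φ → isAut φ ≟Bool true) {xs = allEndo p} φ∈)

    Aut-complete : (φ : Endo p) → isAut φ ≡ true → ∃ λ ψ → ψ ∈ Aut p × ψ ≈ φ
    Aut-complete φ φ-aut =
      let ψ , ψ∈ , ψ≈φ = allEndo-complete φ in
      ψ , ∈-filter⁺ (λ φ → isAut φ ≟Bool true) ψ∈ (trans (isAut-cong ψ φ ψ≈φ) φ-aut) , ψ≈φ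

    private
      hom? inj? : Endo p → D p → D p → Bool
      hom? φ x y = app φ (x · y) == (app φ x · app φ y)
      inj? φ x y = not (app φ x == app φ y) ∨ (x == y)

      surj? : Endo p → D p → Bool
      surj? φ y = any (λ x → app φ x == y) (allD p)

    preimage : Endo p → D p → D p
    preimage φ y = firstOr (λ x → app φ x == y) y (allD p)

    module _ (φ : Endo p) (φ-aut : isAut φ ≡ true) where

      private
        homs = all (λ x → all (hom? φ x) (allD p)) (allD p)
        injs = all (λ x → all (inj? φ x) (allD p)) (allD p)
        surjs = all (surj? φ) (allD p)
        hom∧rest = ∧≡true⇒ homs (injs ∧ surjs) φ-aut
        inj∧surj = ∧≡true⇒ injs surjs (proj₂ hom∧rest)

      isAut⇒hom : ∀ x y → app φ (x · y) ≡ app φ x · app φ y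
      isAut⇒hom x y = ==⇒≡ _ _
        (all-elim (hom? φ x) (all-elim (λ x → all (hom? φ x) (allD p)) (proj₁ hom∧rest) (∈-allD x)) (∈-allD y))

      isAut⇒injective : ∀ x y → app φ x ≡ app φ y → x ≡ y
      isAut⇒injective x y φx≡φy
        with all-elim (inj? φ x) (all-elim (λ x → all (inj? φ x) (allD p)) (proj₁ inj∧surj) (∈-allD x)) (∈-allD y)
      ... | φx≠φy∨x=y rewrite ≡⇒== _ _ φx≡φy = ==⇒≡ x y φx≠φy∨x=y

      app-preimage : ∀ y → app φ (preimage φ y) ≡ y
      app-preimage y = ==⇒≡ _ _ (firstOr-satisfies (λ x → app φ x == y) y (allD p)
        (all-elim (surj? φ) (proj₂ inj∧surj) (∈-allD y)))

      preimage-app : ∀ x → preimage φ (app φ x) ≡ x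
      preimage-app x = isAut⇒injective _ x (app-preimage (app φ x))

    hom∧bijective⇒isAut : (φ : Endo p) →
      (∀ x y → app φ (x · y) ≡ app φ x · app φ y) →
      (∀ x y → app φ x ≡ app φ y → x ≡ y) →
      (∀ y → ∃ λ x → app φ x ≡ y) →
      isAut φ ≡ true
    hom∧bijective⇒isAut φ hom inj surj =
      ∧-true (all-intro (λ x → all (hom? φ x) (allD p)) (allD p) λ {x} _ →
                all-intro (hom? φ x) (allD p) λ {y} _ → ≡⇒== _ _ (hom x y))
             (∧-true (all-intro (λ x → all (inj? φ x) (allD p)) (allD p) λ {x} _ →
                        all-intro (inj? φ x) (allD p) λ {y} _ → injective x y)
                     (all-intro (surj? φ) (allD p) λ {y} _ → let x , φx≡y = surj y in
                        any-intro (λ x → app φ x == y) (∈-allD x) (≡⇒== _ _ φx≡y)))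
      where
      ∧-true : ∀ {a b} → a ≡ true → b ≡ true → a ∧ b ≡ true
      ∧-true refl refl = refl
      injective : ∀ x y → not (app φ x == app φ y) ∨ (x == y) ≡ true
      injective x y with app φ x == app φ y in φx==φy
      ... | false = refl
      ... | true  = ≡⇒== x y (inj x y (==⇒≡ _ _ φx==φy))

    infixr 9 _∘ₑ_
    _∘ₑ_ : Endo p → Endo p → Endo p
    φ ∘ₑ ψ = app φ ∘ app ψ ∘ rotation , app φ ∘ app ψ ∘ reflection

    app-∘ₑ : (φ ψ : Endo p) (x : D p) → app (φ ∘ₑ ψ) x ≡ app φ (app ψ x)
    app-∘ₑ φ ψ (false , a) = refl
    app-∘ₑ φ ψ (true  , a) = refl

    ∘ₑ-isAut : (φ ψ : Endo p) → isAut φ ≡ true → isAut ψ ≡ true → isAut (φ ∘ₑ ψ) ≡ true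
    ∘ₑ-isAut φ ψ φ-aut ψ-aut = hom∧bijective⇒isAut (φ ∘ₑ ψ) hom inj surj
      where
      hom : ∀ x y → app (φ ∘ₑ ψ) (x · y) ≡ app (φ ∘ₑ ψ) x · app (φ ∘ₑ ψ) y
      hom x y = begin
        app (φ ∘ₑ ψ) (x · y)                    ≡⟨ app-∘ₑ φ ψ (x · y) ⟩
        app φ (app ψ (x · y))                   ≡⟨ cong (app φ) (isAut⇒hom ψ ψ-aut x y) ⟩
        app φ (app ψ x · app ψ y)               ≡⟨ isAut⇒hom φ φ-aut (app ψ x) (app ψ y) ⟩
        app φ (app ψ x) · app φ (app ψ y)       ≡⟨ cong₂ _·_ (app-∘ₑ φ ψ x) (app-∘ₑ φ ψ y) ⟨
        app (φ ∘ₑ ψ) x · app (φ ∘ₑ ψ) y         ∎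
        where open ≡-Reasoning
      inj : ∀ x y → app (φ ∘ₑ ψ) x ≡ app (φ ∘ₑ ψ) y → x ≡ y
      inj x y eq = isAut⇒injective ψ ψ-aut x y (isAut⇒injective φ φ-aut (app ψ x) (app ψ y)
        (trans (sym (app-∘ₑ φ ψ x)) (trans eq (app-∘ₑ φ ψ y))))
      surj : ∀ y → ∃ λ x → app (φ ∘ₑ ψ) x ≡ y
      surj y = preimage ψ (preimage φ y) ,
        trans (app-∘ₑ φ ψ (preimage ψ (preimage φ y)))
              (trans (cong (app φ) (app-preimage ψ ψ-aut (preimage φ y))) (app-preimage φ φ-aut y))

    inverse : Endo p → Endo p
    inverse φ = preimage φ ∘ rotation , preimage φ ∘ reflection

    app-inverse : (φ : Endo p) (x : D p) → app (inverse φ) x ≡ preimage φ x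
    app-inverse φ (false , a) = refl
    app-inverse φ (true  , a) = refl

    inverse-isAut : (φ : Endo p) → isAut φ ≡ true → isAut (inverse φ) ≡ true
    inverse-isAut φ φ-aut = hom∧bijective⇒isAut (inverse φ) hom inj surj
      where
      φ⁻¹ = app (inverse φ)
      φ∘φ⁻¹ : ∀ x → app φ (φ⁻¹ x) ≡ x
      φ∘φ⁻¹ x = trans (cong (app φ) (app-inverse φ x)) (app-preimage φ φ-aut x)
      hom : ∀ x y → φ⁻¹ (x · y) ≡ φ⁻¹ x · φ⁻¹ y
      hom x y = isAut⇒injective φ φ-aut _ _ (begin
        app φ (φ⁻¹ (x · y))                 ≡⟨ φ∘φ⁻¹ (x · y) ⟩
        x · y                               ≡⟨ cong₂ _·_ (φ∘φ⁻¹ x) (φ∘φ⁻¹ y) ⟨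
        app φ (φ⁻¹ x) · app φ (φ⁻¹ y)       ≡⟨ isAut⇒hom φ φ-aut (φ⁻¹ x) (φ⁻¹ y) ⟨
        app φ (φ⁻¹ x · φ⁻¹ y)               ∎)
        where open ≡-Reasoning
      inj : ∀ x y → φ⁻¹ x ≡ φ⁻¹ y → x ≡ y
      inj x y eq = trans (sym (φ∘φ⁻¹ x)) (trans (cong (app φ) eq) (φ∘φ⁻¹ y))
      surj : ∀ y → ∃ λ x → φ⁻¹ x ≡ y
      surj y = app φ y , trans (app-inverse φ (app φ y)) (preimage-app φ φ-aut y)

    countTrue-Aut-≤-∘ₑ : (φ : Endo p) → isAut φ ≡ true → (P Q : Endo p → Bool) →
      (∀ χ ψ → χ ≈ ψ → Q χ ≡ Q ψ) →
      (∀ {ψ} → ψ ∈ Aut p → P ψ ≡ true → Q (φ ∘ₑ ψ) ≡ true) →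
      countTrue P (Aut p) ≤ countTrue Q (Aut p)
    countTrue-Aut-≤-∘ₑ φ φ-aut P Q Q-resp P⇒Q∘φ = begin
      countTrue P (Aut p)             ≡⟨ length-map (table ∘ (φ ∘ₑ_)) Ps ⟨
      length (map (table ∘ (φ ∘ₑ_)) Ps) ≤⟨ Unique⇒length≤ φPs-unique φPs⊆Qs ⟩
      length (map table Qs)           ≡⟨ length-map table Qs ⟩
      countTrue Q (Aut p)             ∎
      where
      open ≤-Reasoning
      Ps = filter (λ ψ → P ψ ≟Bool true) (Aut p)
      Qs = filter (λ ψ → Q ψ ≟Bool true) (Aut p)
      φ∘-injective : ∀ ψ ψ′ → table (φ ∘ₑ ψ) ≡ table (φ ∘ₑ ψ′) → table ψ ≡ table ψ′
      φ∘-injective ψ ψ′ eq = table-cong ψ ψ′ λ x → isAut⇒injective φ φ-aut _ _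
        (trans (sym (app-∘ₑ φ ψ x)) (trans (table-injective _ _ eq x) (app-∘ₑ φ ψ′ x)))
      φPs-unique : Unique (map (table ∘ (φ ∘ₑ_)) Ps)
      φPs-unique = Unique-map-via table (table ∘ (φ ∘ₑ_)) Ps (λ {ψ} {ψ′} _ _ → φ∘-injective ψ ψ′)
        (Unique-map-filter table P (Aut p) Aut-unique)
      φPs⊆Qs : map (table ∘ (φ ∘ₑ_)) Ps ⊆ map table Qs
      φPs⊆Qs t∈ with ∈-map⁻ (table ∘ (φ ∘ₑ_)) t∈
      ... | ψ , ψ∈Ps , refl =
        let ψ∈ , Pψ = ∈-filter⁻ (λ ψ → P ψ ≟Bool true) {xs = Aut p} ψ∈Ps
            χ , χ∈ , χ≈φψ = Aut-complete (φ ∘ₑ ψ) (∘ₑ-isAut φ ψ φ-aut (Aut-sound ψ∈))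
        in subst (_∈ map table Qs) (table-cong χ (φ ∘ₑ ψ) χ≈φψ)
             (∈-map⁺ table (∈-filter⁺ (λ ψ → Q ψ ≟Bool true) χ∈
               (trans (Q-resp χ (φ ∘ₑ ψ) χ≈φψ) (P⇒Q∘φ ψ∈ Pψ))))

    agreesOn : {k : ℕ} → (D p → D p) → (Fin k → D p) → Endo p → Bool
    agreesOn {k} g xs φ = all (λ i → app φ (xs i) == g (xs i)) (allFin k)

    agreesOn-resp-≈ : {k : ℕ} (g : D p → D p) (xs : Fin k → D p) →
      ∀ χ ψ → χ ≈ ψ → agreesOn g xs χ ≡ agreesOn g xs ψ
    agreesOn-resp-≈ {k} g xs χ ψ χ≈ψ = all-cong (λ i → cong (_== g (xs i)) (χ≈ψ (xs i))) (allFin k)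

    agreesOn⇒ : {k : ℕ} (g : D p → D p) (xs : Fin k → D p) (φ : Endo p) →
      agreesOn g xs φ ≡ true → ∀ i → app φ (xs i) ≡ g (xs i)
    agreesOn⇒ g xs φ agree i = ==⇒≡ _ _ (all-elim (λ i → app φ (xs i) == g (xs i)) agree (∈-allFin i))

    ⇒agreesOn : {k : ℕ} (g : D p → D p) (xs : Fin k → D p) (φ : Endo p) →
      (∀ i → app φ (xs i) ≡ g (xs i)) → agreesOn g xs φ ≡ true
    ⇒agreesOn {k} g xs φ agree = all-intro _ (allFin k) λ {i} _ → ≡⇒== _ _ (agree i)

    -- The automorphisms agreeing with f on xs are empty or a coset φ ∘ Stab(xs).
    countTrue-agreesOn : {k : ℕ} (f : D p → D p) (xs : Fin k → D p) →
      countTrue (agreesOn f xs) (Aut p) ≡ (if accepts f xs then stabSize xs else 0)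
    countTrue-agreesOn f xs with accepts f xs in acc
    ... | false = countTrue≡0 (agreesOn f xs) (Aut p) λ φ∈ agree →
                    case trans (sym (any-intro (agreesOn f xs) φ∈ agree)) acc of λ ()
    ... | true  = ≤-antisym
      (countTrue-Aut-≤-∘ₑ φ⁻¹ φ⁻¹-aut (agreesOn f xs) (agreesOn (λ x → x) xs) (agreesOn-resp-≈ (λ x → x) xs)
        λ {ψ} _ ψ-agree → ⇒agreesOn (λ x → x) xs (φ⁻¹ ∘ₑ ψ) λ i → begin
          app (φ⁻¹ ∘ₑ ψ) (xs i)         ≡⟨ app-∘ₑ φ⁻¹ ψ (xs i) ⟩
          app φ⁻¹ (app ψ (xs i))        ≡⟨ cong (app φ⁻¹) (agreesOn⇒ f xs ψ ψ-agree i) ⟩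
          app φ⁻¹ (f (xs i))            ≡⟨ cong (app φ⁻¹) (agreesOn⇒ f xs φ φ-agree i) ⟨
          app φ⁻¹ (app φ (xs i))        ≡⟨ app-inverse φ (app φ (xs i)) ⟩
          preimage φ (app φ (xs i))     ≡⟨ preimage-app φ φ-aut (xs i) ⟩
          xs i                          ∎)
      (countTrue-Aut-≤-∘ₑ φ φ-aut (agreesOn (λ x → x) xs) (agreesOn f xs) (agreesOn-resp-≈ f xs)
        λ {ψ} _ ψ-fix → ⇒agreesOn f xs (φ ∘ₑ ψ) λ i → begin
          app (φ ∘ₑ ψ) (xs i)           ≡⟨ app-∘ₑ φ ψ (xs i) ⟩
          app φ (app ψ (xs i))          ≡⟨ cong (app φ) (agreesOn⇒ (λ x → x) xs ψ ψ-fix i) ⟩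
          app φ (xs i)                  ≡⟨ agreesOn⇒ f xs φ φ-agree i ⟩
          f (xs i)                      ∎)
      where
      open ≡-Reasoning
      agreeing = any-elim (agreesOn f xs) (Aut p) acc
      φ = proj₁ agreeing
      φ-aut = Aut-sound (proj₁ (proj₂ agreeing))
      φ-agree = proj₂ (proj₂ agreeing)
      φ⁻¹ = inverse φ
      φ⁻¹-aut = inverse-isAut φ φ-aut

    agreement : (D p → D p) → Endo p → ℕ
    agreement g φ = countTrue (λ x → app φ x == g x) (allD p)

    fixes : Endo p → D p → Bool
    fixes φ x = app φ x == x

    fixedPoints : Endo p → ℕ
    fixedPoints = agreement (λ x → x)

    identity : Endo p
    identity = rotation , reflection

    app-identity : (x : D p) → app identity x ≡ x
    app-identity (false , a) = refl
    app-identity (true  , a) = refl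

    identity-isAut : isAut identity ≡ true
    identity-isAut = hom∧bijective⇒isAut identity
      (λ x y → trans (app-identity (x · y)) (sym (cong₂ _·_ (app-identity x) (app-identity y))))
      (λ x y eq → trans (sym (app-identity x)) (trans eq (app-identity y)))
      (λ y → y , app-identity y)

    -- The representative of the identity in the enumeration Aut p.
    ι : Endo p
    ι = proj₁ (Aut-complete identity identity-isAut)

    ι∈Aut : ι ∈ Aut p
    ι∈Aut = proj₁ (proj₂ (Aut-complete identity identity-isAut))

    fixedPoints-ι : fixedPoints ι ≡ p + p
    fixedPoints-ι = trans (countTrue-all (fixes ι) (allD p) λ {x} _ → ≡⇒== (app ι x) x ι-fixes-x) length-allD
      where
      ι-fixes-x : ∀ {x} → app ι x ≡ x
      ι-fixes-x {x} = trans (proj₂ (proj₂ (Aut-complete identity identity-isAut)) x) (app-identity x)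

    ∑-countTrue-agreesOn : (g : D p → D p) (k : ℕ) →
      ∑ (λ xs → countTrue (agreesOn g xs) (Aut p)) (allFuns k (allD p)) ≡ ∑ (λ φ → agreement g φ ^ k) (Aut p)
    ∑-countTrue-agreesOn g k =
      trans (countTrue-swap (λ xs φ → agreesOn g xs φ) (allFuns k (allD p)) (Aut p))
            (∑-cong (λ φ → countTrue-allFuns (λ x → app φ x == g x) k (allD p)) (Aut p))


    totalWeight : ℕ → ℕ
    totalWeight k = sum (map stabSize (allFuns k (allD p)))

    totalWeight≡∑-fixedPoints-^ : (k : ℕ) → totalWeight k ≡ ∑ (λ φ → fixedPoints φ ^ k) (Aut p)
    totalWeight≡∑-fixedPoints-^ = ∑-countTrue-agreesOn (λ x → x)

    totalWeight>0 : (k : ℕ) → 0 < totalWeight k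
    totalWeight>0 k = begin-strict
      0                                     <⟨ m^n>0 (p + p) {{>-nonZero (≤-trans (>-nonZero⁻¹ p) (m≤m+n p p))}} k ⟩
      (p + p) ^ k                           ≡⟨ cong (_^ k) fixedPoints-ι ⟨
      fixedPoints ι ^ k                     ≤⟨ ∑-∈-≤ (λ φ → fixedPoints φ ^ k) ι∈Aut ⟩
      ∑ (λ φ → fixedPoints φ ^ k) (Aut p)   ≡⟨ totalWeight≡∑-fixedPoints-^ k ⟨
      totalWeight k                         ∎
      where open ≤-Reasoning

    module _ (f : D p → D p) where

      private
        maximum = ∃-maximum (agreement f) ι∈Aut

      bestAut : Endo p
      bestAut = proj₁ maximum

      bestAut∈Aut : bestAut ∈ Aut p
      bestAut∈Aut = proj₁ (proj₂ maximum)

      agreement≤bestAut : ∀ {φ} → φ ∈ Aut p → agreement f φ ≤ agreement f bestAut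
      agreement≤bestAut = proj₂ (proj₂ maximum)

      acceptedWeight : ℕ → ℕ
      acceptedWeight k = sum (map (λ xs → if accepts f xs then stabSize xs else 0) (allFuns k (allD p)))

      acceptedWeight≡∑-agreement-^ : (k : ℕ) → acceptedWeight k ≡ ∑ (λ φ → agreement f φ ^ k) (Aut p)
      acceptedWeight≡∑-agreement-^ k =
        trans (∑-cong (sym ∘ countTrue-agreesOn f) (allFuns k (allD p))) (∑-countTrue-agreesOn f k)

      ∑-agreement²≤∑-fixedPoints² : ∑ (λ φ → agreement f φ ^ 2) (Aut p) ≤ ∑ (λ φ → fixedPoints φ ^ 2) (Aut p)
      ∑-agreement²≤∑-fixedPoints² = begin
        ∑ (λ φ → agreement f φ ^ 2) (Aut p)                   ≡⟨ ∑-countTrue-agreesOn f 2 ⟨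
        ∑ (λ xs → countTrue (agreesOn f xs) (Aut p)) pairs     ≤⟨ ∑-mono pairs (λ {xs} _ → agreeing≤stabSize xs) ⟩
        totalWeight 2                                          ≡⟨ totalWeight≡∑-fixedPoints-^ 2 ⟩
        ∑ (λ φ → fixedPoints φ ^ 2) (Aut p)                   ∎
        where
        open ≤-Reasoning
        pairs = allFuns 2 (allD p)
        agreeing≤stabSize : (xs : Fin 2 → D p) → countTrue (agreesOn f xs) (Aut p) ≤ stabSize xs
        agreeing≤stabSize xs with accepts f xs | countTrue-agreesOn f xs
        ... | true  | eq = ≤-reflexive eq
        ... | false | eq = ≤-trans (≤-reflexive eq) z≤n

  -- Arithmetic modulo p

  module ModularArithmetic (p : ℕ) .{{_ : NonZero p}} where

    toℕ-mod : (m : ℕ) → toℕ (m mod p) ≡ m % p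
    toℕ-mod m = toℕ-fromℕ< (m%n<n m p)

    toℕ%p : (a : Fin p) → toℕ a % p ≡ toℕ a
    toℕ%p a = m<n⇒m%n≡m (toℕ<n a)

    toℕ-addₚ : (a c : Fin p) → toℕ (addₚ a c) ≡ (toℕ a + toℕ c) % p
    toℕ-addₚ a c = toℕ-mod (toℕ a + toℕ c)

    [m+n%p]%p≡[m+n]%p : (m n : ℕ) → (m + n % p) % p ≡ (m + n) % p
    [m+n%p]%p≡[m+n]%p m n = begin
      (m + n % p) % p          ≡⟨ %-distribˡ-+ m (n % p) p ⟩
      (m % p + n % p % p) % p  ≡⟨ cong (λ z → (m % p + z) % p) (m%n%n≡m%n n p) ⟩
      (m % p + n % p) % p      ≡⟨ %-distribˡ-+ m n p ⟨
      (m + n) % p              ∎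
      where open ≡-Reasoning

    [m%p+n]%p≡[m+n]%p : (m n : ℕ) → (m % p + n) % p ≡ (m + n) % p
    [m%p+n]%p≡[m+n]%p m n = begin
      (m % p + n) % p  ≡⟨ cong (_% p) (+-comm (m % p) n) ⟩
      (n + m % p) % p  ≡⟨ [m+n%p]%p≡[m+n]%p n m ⟩
      (n + m) % p      ≡⟨ cong (_% p) (+-comm n m) ⟩
      (m + n) % p      ∎
      where open ≡-Reasoning

    toℕ-subₚ : (a b : Fin p) → toℕ (addₚ a (negₚ b)) ≡ (toℕ a + (p ∸ toℕ b)) % p
    toℕ-subₚ a b = begin
      toℕ (addₚ a (negₚ b))             ≡⟨ toℕ-addₚ a (negₚ b) ⟩
      (toℕ a + toℕ (negₚ b)) % p        ≡⟨ cong (λ z → (toℕ a + z) % p) (toℕ-mod (p ∸ toℕ b)) ⟩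
      (toℕ a + (p ∸ toℕ b) % p) % p     ≡⟨ [m+n%p]%p≡[m+n]%p (toℕ a) (p ∸ toℕ b) ⟩
      (toℕ a + (p ∸ toℕ b)) % p         ∎
      where open ≡-Reasoning

    subₚ-self : (a : Fin p) → toℕ (addₚ a (negₚ a)) ≡ 0
    subₚ-self a = begin
      toℕ (addₚ a (negₚ a))        ≡⟨ toℕ-subₚ a a ⟩
      (toℕ a + (p ∸ toℕ a)) % p    ≡⟨ cong (_% p) (m+[n∸m]≡n (<⇒≤ (toℕ<n a))) ⟩
      p % p                        ≡⟨ n%n≡0 p ⟩
      0                            ∎
      where open ≡-Reasoning

    subₚ≡0⇒≡ : (a b : Fin p) → toℕ (addₚ a (negₚ b)) ≡ 0 → a ≡ b
    subₚ≡0⇒≡ a b a-b≡0 with ≤-<-connex (toℕ b) (toℕ a)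
    ... | inj₁ b≤a = toℕ-injective (≤-antisym (m∸n≡0⇒m≤n a∸b≡0) b≤a)
      where
      a∸b≡0 : toℕ a ∸ toℕ b ≡ 0
      a∸b≡0 = begin
        toℕ a ∸ toℕ b                    ≡⟨ m<n⇒m%n≡m (≤-<-trans (m∸n≤m (toℕ a) (toℕ b)) (toℕ<n a)) ⟨
        (toℕ a ∸ toℕ b) % p              ≡⟨ [m+n]%n≡m%n (toℕ a ∸ toℕ b) p ⟨
        (toℕ a ∸ toℕ b + p) % p          ≡⟨ cong (_% p) (+-comm (toℕ a ∸ toℕ b) p) ⟩
        (p + (toℕ a ∸ toℕ b)) % p        ≡⟨ cong (_% p) (+-∸-assoc p b≤a) ⟨
        (p + toℕ a ∸ toℕ b) % p          ≡⟨ cong (λ z → (z ∸ toℕ b) % p) (+-comm p (toℕ a)) ⟩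
        (toℕ a + p ∸ toℕ b) % p          ≡⟨ cong (_% p) (+-∸-assoc (toℕ a) (<⇒≤ (toℕ<n b))) ⟩
        (toℕ a + (p ∸ toℕ b)) % p        ≡⟨ toℕ-subₚ a b ⟨
        toℕ (addₚ a (negₚ b))            ≡⟨ a-b≡0 ⟩
        0                                ∎
        where open ≡-Reasoning
    ... | inj₂ a<b = ⊥-elim (<⇒≢ (≤-trans (m<n⇒0<n∸m (toℕ<n b)) (m≤n+m _ (toℕ a))) (sym a+[p∸b]≡0))
      where
      a+[p∸b]<p : toℕ a + (p ∸ toℕ b) < p
      a+[p∸b]<p = begin-strict
        toℕ a + (p ∸ toℕ b)  <⟨ +-monoˡ-< (p ∸ toℕ b) a<b ⟩
        toℕ b + (p ∸ toℕ b)  ≡⟨ m+[n∸m]≡n (<⇒≤ (toℕ<n b)) ⟩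
        p                    ∎
        where open ≤-Reasoning
      a+[p∸b]≡0 : toℕ a + (p ∸ toℕ b) ≡ 0
      a+[p∸b]≡0 = trans (sym (m<n⇒m%n≡m a+[p∸b]<p)) (trans (sym (toℕ-subₚ a b)) a-b≡0)

  module Rotations (p : ℕ) .{{_ : NonZero p}} (p-prime : Prime p) where

    open Automorphisms p using (rotation)
    open ModularArithmetic p

    -- In the case 1 + y a = x p the inverse is y² a, because (y a)² ≡ (-1)² mod p.
    ∃-inverse-mod : (a : ℕ) → 0 < a → a < p → ∃ λ u → (u * a) % p ≡ 1
    ∃-inverse-mod a 0<a a<p with coprime-Bézout (prime⇒coprime p-prime {{>-nonZero 0<a}} a<p)
    ... | Bézout.-+ x y 1+xp≡ya = y , (begin
      (y * a) % p        ≡⟨ cong (_% p) 1+xp≡ya ⟨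
      (1 + x * p) % p    ≡⟨ [m+kn]%n≡m%n 1 x p ⟩
      1 % p              ≡⟨ m<n⇒m%n≡m (≤-<-trans 0<a a<p) ⟩
      1                  ∎)
      where open ≡-Reasoning
    ... | Bézout.+- x y 1+ya≡xp = y * y * a , (begin
      (y * y * a * a) % p                   ≡⟨ [m+kn]%n≡m%n (y * y * a * a) (2 * x) p ⟨
      (y * y * a * a + 2 * x * p) % p       ≡⟨ cong (λ z → (y * y * a * a + z) % p) (*-assoc 2 x p) ⟩
      (y * y * a * a + 2 * (x * p)) % p     ≡⟨ cong (_% p) square ⟩
      (1 + x * x * p * p) % p               ≡⟨ [m+kn]%n≡m%n 1 (x * x * p) p ⟩
      1 % p                                 ≡⟨ m<n⇒m%n≡m (≤-<-trans 0<a a<p) ⟩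
      1                                     ∎)
      where
      open ≡-Reasoning
      square : y * y * a * a + 2 * (x * p) ≡ 1 + x * x * p * p
      square = begin
        y * y * a * a + 2 * (x * p)        ≡⟨ cong (λ z → y * y * a * a + 2 * z) 1+ya≡xp ⟨
        y * y * a * a + 2 * (1 + y * a)    ≡⟨ expand y a ⟩
        1 + (1 + y * a) * (1 + y * a)      ≡⟨ cong (λ z → 1 + z * z) 1+ya≡xp ⟩
        1 + x * p * (x * p)                ≡⟨ regroup x p ⟩
        1 + x * x * p * p                  ∎
        where
        expand : ∀ y a → y * y * a * a + 2 * (1 + y * a) ≡ 1 + (1 + y * a) * (1 + y * a)
        expand = solve-∀
        regroup : ∀ x p → 1 + x * p * (x * p) ≡ 1 + x * x * p * p
        regroup = solve-∀

    ∃-multiple≡ : (a c : Fin p) → toℕ a ≢ 0 → ∃ λ m → (suc m * toℕ a) % p ≡ toℕ c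
    ∃-multiple≡ a c a≢0 with ∃-inverse-mod (toℕ a) (n≢0⇒n>0 a≢0) (toℕ<n a)
    ... | u , ua≡1 = u * toℕ c + pred p , (begin
      (suc (u * toℕ c + pred p) * toℕ a) % p       ≡⟨ cong (λ z → (z * toℕ a) % p) 1+m≡uc+p ⟩
      ((u * toℕ c + p) * toℕ a) % p                ≡⟨ cong (_% p) (distrib u (toℕ c) p (toℕ a)) ⟩
      (u * toℕ a * toℕ c + toℕ a * p) % p          ≡⟨ [m+kn]%n≡m%n (u * toℕ a * toℕ c) (toℕ a) p ⟩
      (u * toℕ a * toℕ c) % p                      ≡⟨ %-distribˡ-* (u * toℕ a) (toℕ c) p ⟩
      ((u * toℕ a) % p * (toℕ c % p)) % p          ≡⟨ cong (λ z → (z * (toℕ c % p)) % p) ua≡1 ⟩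
      (1 * (toℕ c % p)) % p                        ≡⟨ cong (_% p) (*-identityˡ (toℕ c % p)) ⟩
      toℕ c % p % p                                ≡⟨ m%n%n≡m%n (toℕ c) p ⟩
      toℕ c % p                                    ≡⟨ toℕ%p c ⟩
      toℕ c                                        ∎)
      where
      open ≡-Reasoning
      1+m≡uc+p : suc (u * toℕ c + pred p) ≡ u * toℕ c + p
      1+m≡uc+p = trans (sym (+-suc (u * toℕ c) (pred p))) (cong (_+_ (u * toℕ c)) (suc-pred p))
      distrib : ∀ u c p a → (u * c + p) * a ≡ u * a * c + a * p
      distrib = solve-∀

    rotations-generated : (C : D p → Set) → (∀ x y → C x → C y → C (x · y)) →
      (a : Fin p) → toℕ a ≢ 0 → C (rotation a) → ∀ c → C (rotation c)
    rotations-generated C C-closed a a≢0 Ca c with ∃-multiple≡ a c a≢0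
    ... | m , ma≡c = subst C (cong rotation (toℕ-injective (trans (toℕ-mod (suc m * toℕ a)) ma≡c))) (C-multiple m)
      where
      C-multiple : ∀ m → C (rotation ((suc m * toℕ a) mod p))
      C-multiple zero    = subst C (cong rotation (toℕ-injective (sym (begin
        toℕ ((1 * toℕ a) mod p)   ≡⟨ toℕ-mod (1 * toℕ a) ⟩
        (toℕ a + 0) % p           ≡⟨ cong (_% p) (+-identityʳ (toℕ a)) ⟩
        toℕ a % p                 ≡⟨ toℕ%p a ⟩
        toℕ a                     ∎)))) Ca
        where open ≡-Reasoning
      C-multiple (suc m) = subst C (cong rotation (toℕ-injective (begin
        toℕ (addₚ ((suc m * toℕ a) mod p) a)            ≡⟨ toℕ-addₚ ((suc m * toℕ a) mod p) a ⟩
        (toℕ ((suc m * toℕ a) mod p) + toℕ a) % p       ≡⟨ cong (λ z → (z + toℕ a) % p)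
                                                             (toℕ-mod (suc m * toℕ a)) ⟩
        ((suc m * toℕ a) % p + toℕ a) % p               ≡⟨ [m%p+n]%p≡[m+n]%p (suc m * toℕ a) (toℕ a) ⟩
        (suc m * toℕ a + toℕ a) % p                     ≡⟨ cong (_% p) (+-comm (suc m * toℕ a) (toℕ a)) ⟩
        (suc (suc m) * toℕ a) % p                       ≡⟨ toℕ-mod (suc (suc m) * toℕ a) ⟨
        toℕ ((suc (suc m) * toℕ a) mod p)               ∎)))
        (C-closed _ _ (C-multiple m) Ca)
        where open ≡-Reasoning

  -- Automorphisms of D p for a prime p > 3

  module DihedralAutomorphisms (p : ℕ) .{{_ : NonZero p}} (p-prime : Prime p) (3<p : 3 < p) where

    open Automorphisms p
    open ModularArithmetic p
    open Rotations p p-prime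

    zeroₚ one : Fin p
    zeroₚ = 0 mod p
    one   = 1 mod p

    toℕ-zeroₚ : toℕ zeroₚ ≡ 0
    toℕ-zeroₚ = trans (toℕ-mod 0) (m<n⇒m%n≡m (>-nonZero⁻¹ p))

    toℕ-one : toℕ one ≡ 1
    toℕ-one = trans (toℕ-mod 1) (m<n⇒m%n≡m (≤-trans (s≤s (s≤s z≤n)) 3<p))

    r s : D p
    r = rotation one
    s = reflection zeroₚ

    reflection≡rotation·s : (c : Fin p) → reflection c ≡ rotation c · s
    reflection≡rotation·s c = cong reflection (toℕ-injective (sym (begin
      toℕ (addₚ c zeroₚ)       ≡⟨ toℕ-addₚ c zeroₚ ⟩
      (toℕ c + toℕ zeroₚ) % p  ≡⟨ cong (λ z → (toℕ c + z) % p) toℕ-zeroₚ ⟩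
      (toℕ c + 0) % p          ≡⟨ cong (_% p) (+-identityʳ (toℕ c)) ⟩
      toℕ c % p                ≡⟨ toℕ%p c ⟩
      toℕ c                    ∎)))
      where open ≡-Reasoning

    -- A reflection is an involution, so it cannot be the image of r, for which r³ ≠ r.
    isAut⇒r↦rotation : (φ : Endo p) → isAut φ ≡ true → proj₁ (app φ r) ≡ false
    isAut⇒r↦rotation φ φ-aut with app φ r in φr
    ... | false , t = refl
    ... | true  , t = case trans (sym toℕ-r³) (trans (cong (toℕ ∘ proj₂) r³≡r) toℕ-one) of λ ()
      where
      t-t+t≡t : addₚ (addₚ t (negₚ t)) t ≡ t
      t-t+t≡t = toℕ-injective (begin
        toℕ (addₚ (addₚ t (negₚ t)) t)             ≡⟨ toℕ-addₚ (addₚ t (negₚ t)) t ⟩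
        (toℕ (addₚ t (negₚ t)) + toℕ t) % p        ≡⟨ cong (λ z → (z + toℕ t) % p) (subₚ-self t) ⟩
        toℕ t % p                                  ≡⟨ toℕ%p t ⟩
        toℕ t                                      ∎)
        where open ≡-Reasoning
      r³≡r : (r · r) · r ≡ r
      r³≡r = isAut⇒injective φ φ-aut _ _ (begin
        app φ ((r · r) · r)                 ≡⟨ isAut⇒hom φ φ-aut (r · r) r ⟩
        app φ (r · r) · app φ r             ≡⟨ cong (_· app φ r) (isAut⇒hom φ φ-aut r r) ⟩
        (app φ r · app φ r) · app φ r       ≡⟨ cong (λ z → (z · z) · z) φr ⟩
        reflection (addₚ (addₚ t (negₚ t)) t) ≡⟨ cong reflection t-t+t≡t ⟩
        reflection t                        ≡⟨ φr ⟨
        app φ r                             ∎)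
        where open ≡-Reasoning
      toℕ-r³ : toℕ (proj₂ ((r · r) · r)) ≡ 3
      toℕ-r³ = begin
        toℕ (addₚ (addₚ one one) one)              ≡⟨ toℕ-addₚ (addₚ one one) one ⟩
        (toℕ (addₚ one one) + toℕ one) % p         ≡⟨ cong (λ z → (z + toℕ one) % p) (toℕ-addₚ one one) ⟩
        ((toℕ one + toℕ one) % p + toℕ one) % p    ≡⟨ cong (λ z → ((z + z) % p + z) % p) toℕ-one ⟩
        (2 % p + 1) % p                            ≡⟨ [m%p+n]%p≡[m+n]%p 2 1 ⟩
        3 % p                                      ≡⟨ m<n⇒m%n≡m 3<p ⟩
        3                                          ∎
        where open ≡-Reasoning

    -- Rotations commute with each other, while s r ≠ r s.
    isAut⇒s↦reflection : (φ : Endo p) → isAut φ ≡ true → proj₁ (app φ s) ≡ true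
    isAut⇒s↦reflection φ φ-aut with app φ s in φs | app φ r in φr | isAut⇒r↦rotation φ φ-aut
    ... | true  , t | _         | _ = refl
    ... | false , t | false , u | _ = ⊥-elim (pred-p≢1 (trans (sym toℕ-sr) (trans (cong (toℕ ∘ proj₂) sr≡rs) toℕ-rs)))
      where
      sr≡rs : s · r ≡ r · s
      sr≡rs = isAut⇒injective φ φ-aut _ _ (begin
        app φ (s · r)              ≡⟨ isAut⇒hom φ φ-aut s r ⟩
        app φ s · app φ r          ≡⟨ cong₂ _·_ φs φr ⟩
        rotation (addₚ t u)        ≡⟨ cong rotation (toℕ-injective (begin
            toℕ (addₚ t u)           ≡⟨ toℕ-addₚ t u ⟩
            (toℕ t + toℕ u) % p      ≡⟨ cong (_% p) (+-comm (toℕ t) (toℕ u)) ⟩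
            (toℕ u + toℕ t) % p      ≡⟨ toℕ-addₚ u t ⟨
            toℕ (addₚ u t)           ∎)) ⟩
        rotation (addₚ u t)        ≡⟨ cong₂ _·_ φr φs ⟨
        app φ r · app φ s          ≡⟨ isAut⇒hom φ φ-aut r s ⟨
        app φ (r · s)              ∎)
        where open ≡-Reasoning
      toℕ-sr : toℕ (proj₂ (s · r)) ≡ pred p
      toℕ-sr = begin
        toℕ (addₚ zeroₚ (negₚ one))           ≡⟨ toℕ-subₚ zeroₚ one ⟩
        (toℕ zeroₚ + (p ∸ toℕ one)) % p       ≡⟨ cong₂ (λ z w → (z + (p ∸ w)) % p) toℕ-zeroₚ toℕ-one ⟩
        pred p % p                            ≡⟨ m<n⇒m%n≡m (≤-reflexive (suc-pred p)) ⟩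
        pred p                                ∎
        where open ≡-Reasoning
      toℕ-rs : toℕ (proj₂ (r · s)) ≡ 1
      toℕ-rs = begin
        toℕ (addₚ one zeroₚ)            ≡⟨ toℕ-addₚ one zeroₚ ⟩
        (toℕ one + toℕ zeroₚ) % p       ≡⟨ cong₂ (λ z w → (z + w) % p) toℕ-one toℕ-zeroₚ ⟩
        1 % p                           ≡⟨ trans (sym (toℕ-mod 1)) toℕ-one ⟩
        1                               ∎
        where open ≡-Reasoning
      pred-p≢1 : pred p ≢ 1
      pred-p≢1 pred-p≡1 with subst (3 <_) (trans (sym (suc-pred p)) (cong suc pred-p≡1)) 3<p
      ... | s≤s (s≤s ())

    isAut-determined-by-r-s : (φ ψ : Endo p) → isAut φ ≡ true → isAut ψ ≡ true →
      app φ r ≡ app ψ r → app φ s ≡ app ψ s → φ ≈ ψ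
    isAut-determined-by-r-s φ ψ φ-aut ψ-aut φr≡ψr φs≡ψs = φ≈ψ
      where
      Agree : D p → Set
      Agree x = app φ x ≡ app ψ x
      Agree-closed : ∀ x y → Agree x → Agree y → Agree (x · y)
      Agree-closed x y φx≡ψx φy≡ψy =
        trans (isAut⇒hom φ φ-aut x y) (trans (cong₂ _·_ φx≡ψx φy≡ψy) (sym (isAut⇒hom ψ ψ-aut x y)))
      φ≈ψ : ∀ x → Agree x
      φ≈ψ (false , c) = rotations-generated Agree Agree-closed one one≢0 φr≡ψr c
        where
        one≢0 : toℕ one ≢ 0
        one≢0 one≡0 = case trans (sym toℕ-one) one≡0 of λ ()
      φ≈ψ (true  , c) = subst Agree (sym (reflection≡rotation·s c))
        (Agree-closed (rotation c) s (φ≈ψ (false , c)) φs≡ψs)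

    length-Aut≤p² : length (Aut p) ≤ p * p
    length-Aut≤p² = begin
      length (Aut p)                          ≡⟨ length-map key (Aut p) ⟨
      length (map key (Aut p))                ≤⟨ Unique⇒length≤ keys-unique keys⊆pairs ⟩
      length (cartesianProduct (allFin p) (allFin p)) ≡⟨ length-cartesianProduct (allFin p) (allFin p) ⟩
      length (allFin p) * length (allFin p)   ≡⟨ cong₂ _*_ (length-allFin p) (length-allFin p) ⟩
      p * p                                   ∎
      where
      open ≤-Reasoning
      key : Endo p → Fin p × Fin p
      key φ = proj₂ (app φ r) , proj₂ (app φ s)
      keys-unique : Unique (map key (Aut p))
      keys-unique = Unique-map-via table key (Aut p) (λ {φ} {ψ} φ∈ ψ∈ keyφ≡keyψ →
        let φ-aut = Aut-sound φ∈ ; ψ-aut = Aut-sound ψ∈ in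
        table-cong φ ψ (isAut-determined-by-r-s φ ψ φ-aut ψ-aut
          (cong₂ _,_ (trans (isAut⇒r↦rotation φ φ-aut) (sym (isAut⇒r↦rotation ψ ψ-aut))) (cong proj₁ keyφ≡keyψ))
          (cong₂ _,_ (trans (isAut⇒s↦reflection φ φ-aut) (sym (isAut⇒s↦reflection ψ ψ-aut)))
                     (cong proj₂ keyφ≡keyψ))))
        Aut-unique
      keys⊆pairs : map key (Aut p) ⊆ cartesianProduct (allFin p) (allFin p)
      keys⊆pairs {a , b} _ = ∈-cartesianProduct⁺ (∈-allFin a) (∈-allFin b)

    fixes-rotation⇒p≤fixedPoints : (φ : Endo p) → isAut φ ≡ true → (a : Fin p) → toℕ a ≢ 0 →
      app φ (rotation a) ≡ rotation a → p ≤ fixedPoints φ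
    fixes-rotation⇒p≤fixedPoints φ φ-aut a a≢0 φa≡a = begin
      p                                          ≡⟨ length-allFin p ⟨
      length (allFin p)                          ≡⟨ countTrue-all (fixes φ ∘ rotation) (allFin p)
                                                      (λ {c} _ → ≡⇒== _ _ (rotations-fixed c)) ⟨
      countTrue (fixes φ ∘ rotation) (allFin p)  ≤⟨ m≤m+n _ _ ⟩
      countTrue (fixes φ ∘ rotation) (allFin p) + countTrue (fixes φ ∘ reflection) (allFin p)
                                                 ≡⟨ countTrue-allD (fixes φ) ⟨
      fixedPoints φ                              ∎
      where
      open ≤-Reasoning
      rotations-fixed : ∀ c → app φ (rotation c) ≡ rotation c
      rotations-fixed = rotations-generated (λ x → app φ x ≡ x)
        (λ x y φx≡x φy≡y → trans (isAut⇒hom φ φ-aut x y) (cong₂ _·_ φx≡x φy≡y)) a a≢0 φa≡a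

    -- The product of two fixed reflections is a fixed rotation.
    fixes-only-trivial-rotation⇒fixedPoints≤2 : (φ : Endo p) → isAut φ ≡ true →
      (∀ a → app φ (rotation a) ≡ rotation a → toℕ a ≡ 0) → fixedPoints φ ≤ 2
    fixes-only-trivial-rotation⇒fixedPoints≤2 φ φ-aut only-trivial = begin
      fixedPoints φ
        ≡⟨ countTrue-allD (fixes φ) ⟩
      countTrue (fixes φ ∘ rotation) (allFin p) + countTrue (fixes φ ∘ reflection) (allFin p)
        ≤⟨ +-mono-≤ (countTrue≤1 _ (allFin p) (Unique.allFin⁺ p) single-rotation)
                    (countTrue≤1 _ (allFin p) (Unique.allFin⁺ p) single-reflection) ⟩
      2 ∎
      where
      open ≤-Reasoning
      trivial : ∀ a → fixes φ (rotation a) ≡ true → toℕ a ≡ 0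
      trivial a fixed = only-trivial a (==⇒≡ _ _ fixed)
      single-rotation : ∀ {a b} → a ∈ allFin p → b ∈ allFin p →
        fixes φ (rotation a) ≡ true → fixes φ (rotation b) ≡ true → a ≡ b
      single-rotation {a} {b} _ _ a-fixed b-fixed =
        toℕ-injective (trans (trivial a a-fixed) (sym (trivial b b-fixed)))
      single-reflection : ∀ {a b} → a ∈ allFin p → b ∈ allFin p →
        fixes φ (reflection a) ≡ true → fixes φ (reflection b) ≡ true → a ≡ b
      single-reflection {a} {b} _ _ a-fixed b-fixed =
        subₚ≡0⇒≡ a b (only-trivial (addₚ a (negₚ b))
          (trans (isAut⇒hom φ φ-aut (reflection a) (reflection b))
                 (cong₂ _·_ (==⇒≡ (app φ (reflection a)) (reflection a) a-fixed)
                            (==⇒≡ (app φ (reflection b)) (reflection b) b-fixed))))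

    fixedPoints-dichotomy : (φ : Endo p) → isAut φ ≡ true → p ≤ fixedPoints φ ⊎ fixedPoints φ ≤ 2
    fixedPoints-dichotomy φ φ-aut
      with any? (λ a → ¬? (toℕ a ≟ 0) ×-dec (app φ (rotation a) ≟D rotation a)) (allFin p)
    ... | yes nontrivial = let a , a≢0 , φa≡a = satisfied nontrivial in
      inj₁ (fixes-rotation⇒p≤fixedPoints φ φ-aut a a≢0 φa≡a)
    ... | no ¬nontrivial = inj₂ (fixes-only-trivial-rotation⇒fixedPoints≤2 φ φ-aut only-trivial)
      where
      only-trivial : ∀ a → app φ (rotation a) ≡ rotation a → toℕ a ≡ 0
      only-trivial a φa≡a with toℕ a ≟ 0
      ... | yes a≡0 = a≡0
      ... | no  a≢0 = ⊥-elim (¬nontrivial (lose (∈-allFin a) (a≢0 , φa≡a)))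

    module _ (f : D p → D p) (i : ℕ) where

      acceptedWeight-bound : acceptedWeight f (3 + i) * p ^ suc i ≤ agreement f (bestAut f) ^ suc i * totalWeight (3 + i)
      acceptedWeight-bound = begin
        acceptedWeight f (3 + i) * T                  ≡⟨ cong (_* T) (acceptedWeight≡∑-agreement-^ f (3 + i)) ⟩
        ∑ (λ φ → agreement f φ ^ (3 + i)) (Aut p) * T
                                                      ≤⟨ *-monoˡ-≤ T (∑-^-≤-max (agreement f) M (suc i) (Aut p)
                                                                                (agreement≤bestAut f)) ⟩
        M ^ suc i * ∑ (λ φ → agreement f φ ^ 2) (Aut p) * T
                                                      ≤⟨ *-monoˡ-≤ T (*-monoʳ-≤ (M ^ suc i) (∑-agreement²≤∑-fixedPoints² f)) ⟩
        M ^ suc i * ∑ (λ φ → fixedPoints φ ^ 2) (Aut p) * T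
                                                      ≡⟨ *-assoc (M ^ suc i) _ T ⟩
        M ^ suc i * (∑ (λ φ → fixedPoints φ ^ 2) (Aut p) * T)
                                                      ≡⟨ cong (M ^ suc i *_) (*-comm _ T) ⟩
        M ^ suc i * (T * ∑ (λ φ → fixedPoints φ ^ 2) (Aut p))
                                                      ≤⟨ *-monoʳ-≤ (M ^ suc i) (^-*-∑²≤∑-^ fixedPoints p i (Aut p)
                                                           ι∈Aut fixedPoints-ι length-Aut≤p²
                                                           (λ φ∈ → fixedPoints-dichotomy _ (Aut-sound φ∈))) ⟩
        M ^ suc i * ∑ (λ φ → fixedPoints φ ^ (3 + i)) (Aut p)
                                                      ≡⟨ cong (M ^ suc i *_) (totalWeight≡∑-fixedPoints-^ (3 + i)) ⟨
        M ^ suc i * totalWeight (3 + i)               ∎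
        where
        open ≤-Reasoning
        T = p ^ suc i
        M = agreement f (bestAut f)

      δ≤[2*agr]^ : δ (3 + i) f ≤ℚ (((+ 2) / 1) *ℚ agr f (bestAut f)) ^ℚ suc i
      δ≤[2*agr]^ = subst (λ n → δ (3 + i) f ≤ℚ (((+ 2) / 1) *ℚ (agreeing ÷ℕ n)) ^ℚ suc i) (sym length-allD)
        (÷ℕ≤[2*÷ℕ]^ _ _ agreeing p (suc i) (totalWeight>0 (3 + i)) (>-nonZero⁻¹ p)
          (subst (λ M → acceptedWeight f (3 + i) * p ^ suc i ≤ M ^ suc i * totalWeight (3 + i))
                 (sym agreeing≡agreement) acceptedWeight-bound))
        where
        agreeing = countTrue (λ x → f x == app (bestAut f) x) (allD p)
        agreeing≡agreement : agreeing ≡ agreement f (bestAut f)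
        agreeing≡agreement = countTrue-cong (λ x → ==-sym (f x) (app (bestAut f) x)) (allD p)

open import Data.Nat using (ℕ; _<_; _∸_; NonZero; suc; z≤n; s≤s)
open import Data.Nat.Primality using (Prime)
open import Data.Bool using (true)
open import Data.Product using (Σ; _×_; _,_)
open import Data.Integer using (+_)
open import Data.Rational using (_≤_; _*_; _/_)
open import Relation.Binary.PropositionalEquality using (_≡_)
open import Defs
open TestDihedral

theorem5p7 : (p : ℕ) .{{_ : NonZero p}} → Prime p → 3 < p →
    (k : ℕ) → 3 Data.Nat.≤ k → (f : D p → D p) →
    Σ (Endo p) (λ φ → isAut φ ≡ true ×
      δ k f ≤ (((+ 2) / 1) * agr f φ) ^ℚ (k ∸ 2))
theorem5p7 p p-prime 3<p (suc (suc (suc i))) (s≤s (s≤s (s≤s z≤n))) f =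
  bestAut f , Aut-sound (bestAut∈Aut f) , δ≤[2*agr]^ f i
  where
  open Automorphisms p
  open DihedralAutomorphisms p p-prime 3<p
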